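{- For the set cover problem on simple set systems over a universe of size $n$, the greedy algorithm outputs a cover using at most $\left(\frac{\ln n}{2}+1\right)$ times the minimum number of sets. Further, there are simple set systems on which the greedy algorithm is off by a factor exceeding $\frac{\ln n}{2}-1$, i.e. it may output a cover using more than $\left(\frac{\ln n}{2}-1\right)$ times the minimum number of sets.
   Context: A set system $\mathcal{S}\subseteq 2^X$ over a universe $X=[n]$ is simple if $|S\cap S'|\le 1$ for all distinct $S,S'\in\mathcal{S}$. In the set cover problem one is given $\mathcal{S}$ whose union is $X$ and must choose a minimum number of sets from $\mathcal{S}$ whose union is $X$. The greedy algorithm repeatedly picks a set of $\mathcal{S}$ covering the maximum number of not-yet-covered elements (ties broken arbitrarily) until all of $X$ is covered. -}

module Defs where

open import Data.Nat using (ℕ; zero; suc; _+_; _*_; _^_; _≤_; _<_; _!)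
open import Data.Fin using (Fin)
open import Data.Fin.Subset using (Subset; _∩_; _∪_; ∣_∣; _∈_; ∁; Nonempty) renaming (⊥ to ∅)
open import Data.List using (List; []; _∷_)
open import Data.Product using (∃; _×_)
open import Relation.Binary.PropositionalEquality using (_≡_; _≢_)

SetSystem : ℕ → ℕ → Set
SetSystem n m = Fin m → Subset n

-- The family really is a set of subsets (no repeated members).
Distinct : ∀ {n m} → SetSystem n m → Set
Distinct S = ∀ i j → S i ≡ S j → i ≡ j

Simple : ∀ {n m} → SetSystem n m → Set
Simple S = ∀ i j → i ≢ j → ∣ S i ∩ S j ∣ ≤ 1

CoversUniverse : ∀ {n m} → SetSystem n m → Set
CoversUniverse S = ∀ x → ∃ λ i → x ∈ S i

unionOf : ∀ {n m} → SetSystem n m → List (Fin m) → Subset n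
unionOf S []       = ∅
unionOf S (i ∷ is) = S i ∪ unionOf S is

IsCover : ∀ {n m} → SetSystem n m → List (Fin m) → Set
IsCover S is = ∀ x → x ∈ unionOf S is

IsOptimum : ∀ {n m} → SetSystem n m → ℕ → Set
IsOptimum S k =
  (∃ λ is → IsCover S is × Data.List.length is ≡ k) ×
  (∀ is → IsCover S is → k ≤ Data.List.length is)

gain : ∀ {n m} → SetSystem n m → Subset n → Fin m → ℕ
gain S C i = ∣ S i ∩ ∁ C ∣

-- GreedyFrom S C is : "is" is a possible run (any tie-breaking) of the
-- greedy algorithm starting with covered set C: it stops exactly when
-- everything is covered, and otherwise picks a set of maximum gain.
data GreedyFrom {n m} (S : SetSystem n m) : Subset n → List (Fin m) → Set where
  done : ∀ {C} → (∀ x → x ∈ C) → GreedyFrom S C []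
  step : ∀ {C i is} →
         Nonempty (∁ C) →
         (∀ j → gain S C j ≤ gain S C i) →
         GreedyFrom S (S i ∪ C) is →
         GreedyFrom S C (i ∷ is)

GreedyRun : ∀ {n m} → SetSystem n m → List (Fin m) → Set
GreedyRun S is = GreedyFrom S ∅ is

-- expScaled x k = k! * Σ_{j=0}^{k} x^j / j!   (scaled partial sum of e^x)
expScaled : ℕ → ℕ → ℕ
expScaled x zero    = 1
expScaled x (suc k) = suc k * expScaled x k + x ^ suc k

-- e^x ≤ N  (for naturals x, N): every partial sum of the exponential
-- series is ≤ N (the partial sums increase to e^x).
ExpLe : ℕ → ℕ → Set
ExpLe x N = ∀ k → expScaled x k ≤ N * k !

-- e^x > N : some partial sum of the exponential series exceeds N.
ExpGt : ℕ → ℕ → Set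
ExpGt x N = ∃ λ k → N * k ! < expScaled x k

{-# OPTIONS --safe #-}
-- Fix an optimal cover and assign every element to a member containing it;
-- A_j is the set of uncovered elements assigned to the j-th member.  While greedy picks
-- members of the optimal cover, each pick removes one member of positive gain.  From the
-- first pick of another set on, simplicity lets that set meet each A_j at most once, so
-- every |A_j| is at most the number r of nonempty A_j, and AM–GM gives Φ² ≤ n ^ r for the
-- potential Φ = Π_j max(1, |A_j|).  After that each pick either empties some A_j (r drops)
-- or has gain d ≥ 2 and multiplies Φ by at most (1 - 1/d) ^ d ≤ 1/e.  Altogether
-- e ^ (2 (|G| - opt)) ≤ n ^ opt.
--
-- On the k × k grid the k columns are an optimal cover, while greedy may
-- take runs of consecutive points, each as long as the number of rows not yet entered.
-- The slack k² + k - (covered points) shrinks by at most the factor (k - 1) / k per run,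
-- so the number T of runs satisfies (k / (k - 1)) ^ T ≥ k + 1, and then
-- e ^ (2 (T + k)) ≥ (k / (k - 1)) ^ (2 (k - 1) (T + k)) > (k²) ^ k.
module Submission where

open import Defs
open import Data.Nat
open import Data.Nat.Properties
open import Data.Nat.DivMod
open import Data.Nat.Tactic.RingSolver using (solve-∀)
open import Data.List using (List; []; _∷_; length)
import Data.List as List
open import Data.List.Properties using (length-tabulate)
open import Data.List.Relation.Unary.Any using (here; there; index)
open import Data.List.Relation.Unary.Any.Properties using (lookup-index)
open import Data.List.Membership.Propositional using () renaming (_∈_ to _∈ₗ_; _∉_ to _∉ₗ_)
open import Data.List.Membership.Propositional.Properties using (∈-tabulate⁺; ∈-lookup)
open import Data.Fin using (Fin; Fin′; zero; suc; toℕ; fromℕ; fromℕ<; inject; splitAt; _↑ˡ_; _↑ʳ_; join)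
open import Data.Sum using (_⊎_; inj₁; inj₂; [_,_]′)
open import Function using (_∘_)
open import Data.Product using (∃; _×_; _,_; proj₁; proj₂)
open import Relation.Binary.PropositionalEquality
open import Relation.Binary.Definitions using (tri<; tri≈; tri>)
open import Relation.Nullary using (Dec; does; yes; no; ¬_; ¬?; _×-dec_; contradiction)
open import Relation.Nullary.Decidable using (dec-true)
open import Relation.Unary using (Decidable)
open import Data.Vec using ([]; _∷_; tabulate)
open import Data.Vec.Properties using (lookup∘tabulate; []=⇒lookup; lookup⇒[]=)
open import Data.Bool using (true; false; if_then_else_)
open import Data.Fin.Subset using (Subset; ∣_∣; _∈_; _∉_; _∩_; _∪_; ∁; Nonempty) renaming (⊥ to ∅)
open import Data.Fin.Subset.Properties
  using (_∈?_; x∈p∩q⁺; x∈p∩q⁻; x∈p∪q⁻; x∈∁p⇒x∉p; x∉p⇒x∈∁p; p⊆q⇒∣p∣≤∣q∣; p⊆p∪q; q⊆p∪q;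
         Empty-unique; ∣⊥∣≡0; ∉⊥)
import Data.Fin.Properties as Fin
open import Data.Fin.Properties using (any?; all?; ¬∀⟶∃¬; ¬∀⟶∃¬-smallest)
open import Algebra.Properties.CommutativeMonoid.Sum +-0-commutativeMonoid
  using (sum; sum-cong-≗; ∑-distrib-+; ∑-comm; sum-replicate-zero)
open import Algebra.Properties.CommutativeMonoid.Sum *-1-commutativeMonoid
  using () renaming (sum to product; ∑-distrib-+ to product-distrib-*)
open import Algebra.Properties.CommutativeSemigroup *-commutativeSemigroup using (x∙yz≈y∙xz)

^-distrib-* : ∀ x y n → (x * y) ^ n ≡ x ^ n * y ^ n
^-distrib-* x y zero    = refl
^-distrib-* x y (suc n) = trans (cong (x * y *_) (^-distrib-* x y n))
                                ([m*n]*[o*p]≡[m*o]*[n*p] x y (x ^ n) (y ^ n))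

-- The two tangent-line bounds for the convex map x ↦ x ^ suc m.
tangent≤^ : ∀ b d m → b ^ suc m + suc m * b ^ m * d ≤ (d + b) ^ suc m
tangent≤^ b d zero = ≤-reflexive (e b d)
  where
  e : ∀ b d → b * 1 + 1 * 1 * d ≡ (d + b) * 1
  e = solve-∀
tangent≤^ b d (suc m) = begin
  b * (b * X) + suc (suc m) * (b * X) * d                      ≤⟨ m≤m+n _ (suc m * X * d * d) ⟩
  b * (b * X) + suc (suc m) * (b * X) * d + suc m * X * d * d  ≡⟨ e b d m X ⟩
  (d + b) * (b * X + suc m * X * d)                            ≤⟨ *-monoʳ-≤ (d + b) (tangent≤^ b d m) ⟩
  (d + b) * (d + b) ^ suc m                                    ∎
  where
  open ≤-Reasoning
  X = b ^ m
  e : ∀ b d m X → b * (b * X) + suc (suc m) * (b * X) * d + suc m * X * d * d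
                ≡ (d + b) * (b * X + suc m * X * d)
  e = solve-∀

^≤tangent : ∀ a d m → (d + a) ^ suc m ≤ a ^ suc m + suc m * (d + a) ^ m * d
^≤tangent a d zero = ≤-reflexive (e a d)
  where
  e : ∀ a d → (d + a) * 1 ≡ a * 1 + 1 * 1 * d
  e = solve-∀
^≤tangent a d (suc m) = begin
  (d + a) * Z                                         ≡⟨ *-distribʳ-+ Z d a ⟩
  d * Z + a * Z                                       ≤⟨ +-monoʳ-≤ (d * Z) (*-monoʳ-≤ a (^≤tangent a d m)) ⟩
  d * Z + a * (a ^ suc m + suc m * Y * d)             ≡⟨ e₁ a d m (a ^ suc m) Y ⟩
  a * a ^ suc m + (suc m * (a * Y) * d + Z * d)       ≤⟨ +-monoʳ-≤ (a * a ^ suc m) (+-monoˡ-≤ (Z * d) aY≤Z) ⟩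
  a * a ^ suc m + (suc m * Z * d + Z * d)             ≡⟨ e₂ a d m (a * a ^ suc m) Z ⟩
  a * a ^ suc m + suc (suc m) * Z * d                 ∎
  where
  open ≤-Reasoning
  Y = (d + a) ^ m
  Z = (d + a) * Y
  aY≤Z : suc m * (a * Y) * d ≤ suc m * Z * d
  aY≤Z = *-monoˡ-≤ d (*-monoʳ-≤ (suc m) (*-monoˡ-≤ Y (m≤n+m a d)))
  e₁ : ∀ a d m P Y → d * ((d + a) * Y) + a * (P + suc m * Y * d)
                   ≡ a * P + (suc m * (a * Y) * d + (d + a) * Y * d)
  e₁ = solve-∀
  e₂ : ∀ a d m P Z → P + (suc m * Z * d + Z * d) ≡ P + suc (suc m) * Z * d
  e₂ = solve-∀

bernoulli : ∀ b m → b ^ suc m + suc m * b ^ m ≤ suc b ^ suc m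
bernoulli b m = subst (λ z → b ^ suc m + z ≤ suc b ^ suc m) (*-identityʳ _) (tangent≤^ b 1 m)

bernoulli-rev : ∀ a m → suc a ^ suc m ≤ a ^ suc m + suc m * suc a ^ m
bernoulli-rev a m = subst (λ z → suc a ^ suc m ≤ a ^ suc m + z) (*-identityʳ _) (^≤tangent a 1 m)

2*^≤suc^ : ∀ q → 2 * suc q ^ suc q ≤ suc (suc q) ^ suc q
2*^≤suc^ q = subst (_≤ suc (suc q) ^ suc q) (cong (suc q ^ suc q +_) (sym (+-identityʳ _)))
                   (bernoulli (suc q) q)

n<2^n : ∀ n → n < 2 ^ n
n<2^n zero    = s≤s z≤n
n<2^n (suc n) = begin-strict
  suc n           ≤⟨ n<2^n n ⟩
  2 ^ n           <⟨ m<m+n (2 ^ n) (m^n>0 2 n) ⟩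
  2 ^ n + 2 ^ n   ≡⟨ cong (2 ^ n +_) (+-identityʳ (2 ^ n)) ⟨
  2 * 2 ^ n       ∎
  where open ≤-Reasoning

suc-∸-≤ : ∀ m n → suc m ∸ n ≤ suc (m ∸ n)
suc-∸-≤ m       zero    = ≤-refl
suc-∸-≤ zero    (suc n) = ≤-trans (m∸n≤m 0 n) z≤n
suc-∸-≤ (suc m) (suc n) = suc-∸-≤ m n

≡-mod∧close⇒≡ : ∀ d .{{_ : NonZero d}} {p q} → p % d ≡ q % d → p ≤ q → q < p + d → p ≡ q
≡-mod∧close⇒≡ d {p} {q} same p≤q q<p+d = begin-equality
  p                 ≡⟨ m≡m%n+[m/n]*n p d ⟩
  p % d + p / d * d ≡⟨ cong₂ (λ r c → r + c * d) same (≤-antisym (/-monoˡ-≤ d p≤q) q/d≤p/d) ⟩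
  q % d + q / d * d ≡⟨ m≡m%n+[m/n]*n q d ⟨
  q                 ∎
  where
  open ≤-Reasoning
  q/d≤p/d : q / d ≤ p / d
  q/d≤p/d = ≤-pred (*-cancelʳ-< d (q / d) (suc (p / d)) (+-cancelˡ-< (q % d) _ _ (begin-strict
    q % d + q / d * d         ≡⟨ m≡m%n+[m/n]*n q d ⟨
    q                         <⟨ q<p+d ⟩
    p + d                     ≡⟨ cong (_+ d) (m≡m%n+[m/n]*n p d) ⟩
    p % d + p / d * d + d     ≡⟨ cong (λ r → r + p / d * d + d) same ⟩
    q % d + p / d * d + d     ≡⟨ +-assoc (q % d) (p / d * d) d ⟩
    q % d + (p / d * d + d)   ≡⟨ cong (q % d +_) (+-comm (p / d * d) d) ⟩
    q % d + suc (p / d) * d   ∎)))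

^-monoʳ-≤′ : ∀ m {a b} → a ≤ b → (m ≡ 0 → b ≤ a) → m ^ a ≤ m ^ b
^-monoʳ-≤′ (suc m) a≤b _   = ^-monoʳ-≤ (suc m) a≤b
^-monoʳ-≤′ zero    a≤b b≤a = ≤-reflexive (cong (0 ^_) (≤-antisym a≤b (b≤a refl)))

-- (1 + 1 / p) ^ c ≤ (c + a′) / a′ when c + a′ ≤ suc p, with 1 ⊔ _ absorbing a′ = 0.
shrink-≤ : ∀ p c a′ → (0 < c + a′ → 0 < a′) → c + a′ ≤ suc p →
           suc p ^ c * (1 ⊔ a′) ≤ p ^ c * (1 ⊔ (c + a′))
shrink-≤ p zero    a′      _     _      = ≤-refl
shrink-≤ p (suc c) zero    stays _      = contradiction (stays (s≤s z≤n)) (<-irrefl refl)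
shrink-≤ p c       (suc b) _     c+a′≤d = begin
  suc p ^ c * suc b           ≤⟨ shrink c (subst (_≤ suc p) (+-comm c (suc b)) c+a′≤d) ⟩
  p ^ c * (c + suc b)         ≡⟨ cong (p ^ c *_) (m≤n⇒m⊔n≡n (≤-trans (s≤s z≤n) (m≤n+m (suc b) c))) ⟨
  p ^ c * (1 ⊔ (c + suc b))   ∎
  where
  open ≤-Reasoning
  shrink : ∀ c → suc b + c ≤ suc p → suc p ^ c * suc b ≤ p ^ c * (c + suc b)
  shrink zero    _   = ≤-refl
  shrink (suc c) size≤d = begin
    suc p * suc p ^ c * suc b     ≡⟨ *-assoc (suc p) (suc p ^ c) (suc b) ⟩
    suc p * (suc p ^ c * suc b)   ≤⟨ *-monoʳ-≤ (suc p) (shrink c b+c≤d) ⟩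
    suc p * (X * β)               ≡⟨ e₁ p X β ⟩
    p * X * β + X * β             ≤⟨ +-monoʳ-≤ (p * X * β) (*-monoʳ-≤ X β≤p) ⟩
    p * X * β + X * p             ≡⟨ e₂ p X β ⟩
    p * X * suc β                 ∎
    where
    X = p ^ c
    β = c + suc b
    b+c≤d : suc b + c ≤ suc p
    b+c≤d = ≤-trans (+-monoʳ-≤ (suc b) (n≤1+n c)) size≤d
    β≤p : β ≤ p
    β≤p = ≤-pred (subst (_≤ suc p) (trans (+-suc (suc b) c) (cong suc (+-comm (suc b) c))) size≤d)
    e₁ : ∀ p X β → suc p * (X * β) ≡ p * X * β + X * β
    e₁ = solve-∀
    e₂ : ∀ p X β → p * X * β + X * p ≡ p * X * suc β
    e₂ = solve-∀

-- Partial sums of the exponential series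

-- q ^ K * expScaled (j / q) K = Σ_{i ≤ K} (K! / i!) q ^ (K ∸ i) j ^ i, see expScaledFrac-scale.
expScaledFrac : ℕ → ℕ → ℕ → ℕ
expScaledFrac q j zero    = 1
expScaledFrac q j (suc K) = suc K * q * expScaledFrac q j K + j ^ suc K

expScaledFrac-scale : ∀ q x K → expScaledFrac q (q * x) K ≡ q ^ K * expScaled x K
expScaledFrac-scale q x zero    = refl
expScaledFrac-scale q x (suc K) = begin
  suc K * q * expScaledFrac q (q * x) K + (q * x) ^ suc K
    ≡⟨ cong₂ (λ a b → suc K * q * a + b) (expScaledFrac-scale q x K) (^-distrib-* q x (suc K)) ⟩
  suc K * q * (q ^ K * expScaled x K) + q ^ suc K * x ^ suc K
    ≡⟨ e (suc K) q (q ^ K) (expScaled x K) (x ^ suc K) ⟩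
  q * q ^ K * (suc K * expScaled x K + x ^ suc K)
    ∎
  where
  open ≡-Reasoning
  e : ∀ k q Q X Y → k * q * (Q * X) + q * Q * Y ≡ q * Q * (k * X + Y)
  e = solve-∀

-- Truncated form of e ^ (1 / q) ≤ q / p for q = suc p; the summand suc j ^ K
-- is what makes the induction on K go through.
expScaledFrac-suc-≤ : ∀ p j K →
  p * expScaledFrac (suc p) (suc j) K + suc j ^ K ≤ suc p * expScaledFrac (suc p) j K
expScaledFrac-suc-≤ p j zero = ≤-reflexive (e p)
  where
  e : ∀ p → p * 1 + 1 ≡ suc p * 1
  e = solve-∀
expScaledFrac-suc-≤ p j (suc K) = begin
  p * (k * q * B + suc j ^ k) + suc j ^ k       ≡⟨ e₁ p K B (suc j ^ k) ⟩
  k * q * (p * B) + q * suc j ^ k               ≤⟨ +-monoʳ-≤ (k * q * (p * B)) (*-monoʳ-≤ q (bernoulli-rev j K)) ⟩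
  k * q * (p * B) + q * (j ^ k + k * suc j ^ K) ≡⟨ e₂ p K B (j ^ k) (suc j ^ K) ⟩
  k * q * (p * B + suc j ^ K) + q * j ^ k       ≤⟨ +-monoˡ-≤ (q * j ^ k) (*-monoʳ-≤ (k * q) IH) ⟩
  k * q * (q * A) + q * j ^ k                   ≡⟨ e₃ p K A (j ^ k) ⟩
  q * (k * q * A + j ^ k)                       ∎
  where
  open ≤-Reasoning
  q = suc p
  k = suc K
  A = expScaledFrac q j K
  B = expScaledFrac q (suc j) K
  IH = expScaledFrac-suc-≤ p j K
  e₁ : ∀ p K B X → p * (suc K * suc p * B + X) + X ≡ suc K * suc p * (p * B) + suc p * X
  e₁ = solve-∀
  e₂ : ∀ p K B Y Z → suc K * suc p * (p * B) + suc p * (Y + suc K * Z)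
                   ≡ suc K * suc p * (p * B + Z) + suc p * Y
  e₂ = solve-∀
  e₃ : ∀ p K A Y → suc K * suc p * (suc p * A) + suc p * Y ≡ suc p * (suc K * suc p * A + Y)
  e₃ = solve-∀

expScaledFrac-+-≤ : ∀ p i j K →
  p ^ i * expScaledFrac (suc p) (i + j) K ≤ suc p ^ i * expScaledFrac (suc p) j K
expScaledFrac-+-≤ p zero    j K = ≤-refl
expScaledFrac-+-≤ p (suc i) j K = begin
  p * p ^ i * E (suc (i + j))     ≡⟨ *-assoc p (p ^ i) _ ⟩
  p * (p ^ i * E (suc (i + j)))   ≡⟨ x∙yz≈y∙xz p (p ^ i) _ ⟩
  p ^ i * (p * E (suc (i + j)))   ≤⟨ *-monoʳ-≤ (p ^ i) (m+n≤o⇒m≤o _ (expScaledFrac-suc-≤ p (i + j) K)) ⟩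
  p ^ i * (q * E (i + j))         ≡⟨ x∙yz≈y∙xz q (p ^ i) _ ⟨
  q * (p ^ i * E (i + j))         ≤⟨ *-monoʳ-≤ q (expScaledFrac-+-≤ p i j K) ⟩
  q * (q ^ i * E j)               ≡⟨ *-assoc q (q ^ i) _ ⟨
  q * q ^ i * E j                 ∎
  where
  open ≤-Reasoning
  q = suc p
  E : ℕ → ℕ
  E j = expScaledFrac q j K

-- e ≤ (1 + 1 / p) ^ (p + 1), multiplied out on the partial sums of e ^ x.
expScaled-suc-≤ : ∀ p x K → p ^ suc p * expScaled (suc x) K ≤ suc p ^ suc p * expScaled x K
expScaled-suc-≤ p x K = *-cancelˡ-≤ (q ^ K) {{m^n≢0 q K}} (begin
  q ^ K * (p ^ q * expScaled (suc x) K)   ≡⟨ x∙yz≈y∙xz (q ^ K) (p ^ q) _ ⟩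
  p ^ q * (q ^ K * expScaled (suc x) K)   ≡⟨ cong (p ^ q *_) (expScaledFrac-scale q (suc x) K) ⟨
  p ^ q * expScaledFrac q (q * suc x) K   ≡⟨ cong (λ z → p ^ q * expScaledFrac q z K) (*-suc q x) ⟩
  p ^ q * expScaledFrac q (q + q * x) K   ≤⟨ expScaledFrac-+-≤ p q (q * x) K ⟩
  q ^ q * expScaledFrac q (q * x) K       ≡⟨ cong (q ^ q *_) (expScaledFrac-scale q x K) ⟩
  q ^ q * (q ^ K * expScaled x K)         ≡⟨ x∙yz≈y∙xz (q ^ q) (q ^ K) _ ⟩
  q ^ K * (q ^ q * expScaled x K)         ∎)
  where
  open ≤-Reasoning
  q = suc p

expScaled-+-≤ : ∀ p i x K →
  (p ^ suc p) ^ i * expScaled (i + x) K ≤ (suc p ^ suc p) ^ i * expScaled x K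
expScaled-+-≤ p zero    x K = ≤-refl
expScaled-+-≤ p (suc i) x K = begin
  X * X ^ i * expScaled (suc (i + x)) K   ≡⟨ *-assoc X (X ^ i) _ ⟩
  X * (X ^ i * expScaled (suc (i + x)) K) ≡⟨ x∙yz≈y∙xz X (X ^ i) _ ⟩
  X ^ i * (X * expScaled (suc (i + x)) K) ≤⟨ *-monoʳ-≤ (X ^ i) (expScaled-suc-≤ p (i + x) K) ⟩
  X ^ i * (Y * expScaled (i + x) K)       ≡⟨ x∙yz≈y∙xz (X ^ i) Y _ ⟩
  Y * (X ^ i * expScaled (i + x) K)       ≤⟨ *-monoʳ-≤ Y (expScaled-+-≤ p i x K) ⟩
  Y * (Y ^ i * expScaled x K)             ≡⟨ *-assoc Y (Y ^ i) _ ⟨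
  Y * Y ^ i * expScaled x K               ∎
  where
  open ≤-Reasoning
  X = p ^ suc p
  Y = suc p ^ suc p

expScaledFrac-suc-≥ : ∀ q j K →
  suc q * suc K * expScaledFrac q j K + j ^ suc K ≤ expScaledFrac q (suc j) (suc K)
expScaledFrac-suc-≥ q j zero = ≤-reflexive (e q j)
  where
  e : ∀ q j → suc q * 1 * 1 + j * 1 ≡ 1 * q * 1 + suc j * 1
  e = solve-∀
expScaledFrac-suc-≥ q j (suc K) = begin
  suc q * k * (suc K * q * A + j ^ suc K) + j ^ k   ≡⟨ e q K A (j ^ suc K) (j ^ k) ⟩
  k * q * B + (j ^ k + k * j ^ suc K)               ≤⟨ +-monoʳ-≤ (k * q * B) (bernoulli j (suc K)) ⟩
  k * q * B + suc j ^ k                             ≤⟨ +-monoˡ-≤ (suc j ^ k) (*-monoʳ-≤ (k * q) IH) ⟩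
  k * q * expScaledFrac q (suc j) (suc K) + suc j ^ k ∎
  where
  open ≤-Reasoning
  k = suc (suc K)
  A = expScaledFrac q j K
  B = suc q * suc K * A + j ^ suc K
  IH = expScaledFrac-suc-≥ q j K
  e : ∀ q K A Y W → suc q * suc (suc K) * (suc K * q * A + Y) + W
                  ≡ suc (suc K) * q * (suc q * suc K * A + Y) + (W + suc (suc K) * Y)
  e = solve-∀

^*!≤expScaledFrac : ∀ q i → suc q ^ i * i ! ≤ expScaledFrac q i i
^*!≤expScaledFrac q zero    = ≤-refl
^*!≤expScaledFrac q (suc i) = begin
  suc q * suc q ^ i * (suc i * i !)   ≡⟨ [m*n]*[o*p]≡[m*o]*[n*p] (suc q) (suc q ^ i) (suc i) (i !) ⟩
  suc q * suc i * (suc q ^ i * i !)   ≤⟨ *-monoʳ-≤ (suc q * suc i) (^*!≤expScaledFrac q i) ⟩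
  suc q * suc i * expScaledFrac q i i ≤⟨ ≤-trans (m≤m+n _ _) (expScaledFrac-suc-≥ q i i) ⟩
  expScaledFrac q (suc i) (suc i)     ∎
  where open ≤-Reasoning

-- (1 + 1 / q) ^ (q x) ≤ e ^ x, read off the (q x)-th partial sum.
^*!≤expScaled : ∀ q x → suc q ^ (q * x) * (q * x) ! ≤ q ^ (q * x) * expScaled x (q * x)
^*!≤expScaled q x = ≤-trans (^*!≤expScaledFrac q (q * x)) (≤-reflexive (expScaledFrac-scale q x (q * x)))

expScaled-mono-≤ : ∀ {x y} → x ≤ y → ∀ K → expScaled x K ≤ expScaled y K
expScaled-mono-≤ x≤y zero    = ≤-refl
expScaled-mono-≤ x≤y (suc K) = +-mono-≤ (*-monoʳ-≤ (suc K) (expScaled-mono-≤ x≤y K)) (^-monoˡ-≤ (suc K) x≤y)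

expScaled-zero : ∀ K → expScaled 0 K ≡ K !
expScaled-zero zero    = refl
expScaled-zero (suc K) = trans (+-identityʳ _) (cong (suc K *_) (expScaled-zero K))

ExpLe-zero : ∀ {N} → 1 ≤ N → ExpLe 0 N
ExpLe-zero {N} 1≤N K = begin
  expScaled 0 K ≡⟨ expScaled-zero K ⟩
  K !           ≡⟨ *-identityˡ (K !) ⟨
  1 * K !       ≤⟨ *-monoˡ-≤ (K !) 1≤N ⟩
  N * K !       ∎
  where open ≤-Reasoning

ExpLe-mono : ∀ {x y M N} → x ≤ y → M ≤ N → ExpLe y M → ExpLe x N
ExpLe-mono x≤y M≤N e^y≤M K = ≤-trans (expScaled-mono-≤ x≤y K) (≤-trans (e^y≤M K) (*-monoˡ-≤ (K !) M≤N))

-- e ^ (i + x) ≤ (1 + 1 / p) ^ ((p + 1) i) · e ^ x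
ExpLe-+ : ∀ p .{{_ : NonZero p}} i {x M N} →
  (suc p ^ suc p) ^ i * M ≤ (p ^ suc p) ^ i * N → ExpLe x M → ExpLe (i + x) N
ExpLe-+ p i {x} {M} {N} YM≤XN e^x≤M K = *-cancelˡ-≤ (X ^ i) {{m^n≢0 X i {{m^n≢0 p (suc p)}}}} (begin
  X ^ i * expScaled (i + x) K   ≤⟨ expScaled-+-≤ p i x K ⟩
  Y ^ i * expScaled x K         ≤⟨ *-monoʳ-≤ (Y ^ i) (e^x≤M K) ⟩
  Y ^ i * (M * K !)             ≡⟨ *-assoc (Y ^ i) M (K !) ⟨
  Y ^ i * M * K !               ≤⟨ *-monoˡ-≤ (K !) YM≤XN ⟩
  X ^ i * N * K !               ≡⟨ *-assoc (X ^ i) N (K !) ⟩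
  X ^ i * (N * K !)             ∎)
  where
  open ≤-Reasoning
  X = p ^ suc p
  Y = suc p ^ suc p

ExpGt-of-^ : ∀ q x N → N * q ^ (q * x) < suc q ^ (q * x) → ExpGt x N
ExpGt-of-^ q x N N<[1+1/q]^qx = K , *-cancelˡ-< (q ^ K) (N * K !) (expScaled x K) (begin-strict
  q ^ K * (N * K !)   ≡⟨ x∙yz≈y∙xz (q ^ K) N (K !) ⟩
  N * (q ^ K * K !)   ≡⟨ *-assoc N (q ^ K) (K !) ⟨
  N * q ^ K * K !     <⟨ *-monoˡ-< (K !) {{K !≢0}} N<[1+1/q]^qx ⟩
  suc q ^ K * K !     ≤⟨ ^*!≤expScaled q x ⟩
  q ^ K * expScaled x K ∎)
  where
  open ≤-Reasoning
  K = q * x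

-- Finite sums and products

sum-mono-≤ : ∀ {k} {f g : Fin k → ℕ} → (∀ i → f i ≤ g i) → sum f ≤ sum g
sum-mono-≤ {zero}  f≤g = ≤-refl
sum-mono-≤ {suc k} f≤g = +-mono-≤ (f≤g zero) (sum-mono-≤ (f≤g ∘ suc))

sum-mono-< : ∀ {k} {f g : Fin k → ℕ} → (∀ i → f i ≤ g i) → ∀ j → f j < g j → sum f < sum g
sum-mono-< {suc k} f≤g zero    fj<gj = +-mono-<-≤ fj<gj (sum-mono-≤ (f≤g ∘ suc))
sum-mono-< {suc k} f≤g (suc j) fj<gj = +-mono-≤-< (f≤g zero) (sum-mono-< (f≤g ∘ suc) j fj<gj)

product-mono-≤ : ∀ {k} {f g : Fin k → ℕ} → (∀ i → f i ≤ g i) → product f ≤ product g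
product-mono-≤ {zero}  f≤g = ≤-refl
product-mono-≤ {suc k} f≤g = *-mono-≤ (f≤g zero) (product-mono-≤ (f≤g ∘ suc))

product-^ : ∀ {k} d (c : Fin k → ℕ) → product (λ i → d ^ c i) ≡ d ^ sum c
product-^ {zero}  d c = refl
product-^ {suc k} d c = trans (cong (d ^ c zero *_) (product-^ d (c ∘ suc)))
                              (sym (^-distribˡ-+-* d (c zero) (sum (c ∘ suc))))

-- 1 ⊓ n is the indicator of n ≢ 0, and 1 ⊔ n replaces 0 by 1.
nonzeroCount : ∀ {k} → (Fin k → ℕ) → ℕ
nonzeroCount a = sum (λ j → 1 ⊓ a j)

nonzeroProduct : ∀ {k} → (Fin k → ℕ) → ℕ
nonzeroProduct a = product (λ j → 1 ⊔ a j)

nonzeroCount≤ : ∀ {k} (a : Fin k → ℕ) → nonzeroCount a ≤ k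
nonzeroCount≤ {zero}  a = z≤n
nonzeroCount≤ {suc k} a = +-mono-≤ (m⊓n≤m 1 (a zero)) (nonzeroCount≤ (a ∘ suc))

nonzeroProduct>0 : ∀ {k} (a : Fin k → ℕ) → 0 < nonzeroProduct a
nonzeroProduct>0 {zero}  a = s≤s z≤n
nonzeroProduct>0 {suc k} a = *-mono-≤ (m≤m⊔n 1 (a zero)) (nonzeroProduct>0 (a ∘ suc))

-- AM–GM for R copies of suc R * s and one of suc R * (R * y), whose mean is
-- R * (s + y); each case compares with a tangent line of x ↦ x ^ suc R.
amgm-step-scaled : ∀ R s y → (suc R * s) ^ R * suc R * (R * y) ≤ (R * (s + y)) ^ suc R
amgm-step-scaled R s y with ≤-total s (R * y)
... | inj₁ s≤Ry = begin
  B ^ R * suc R * (R * y)          ≡⟨ cong (λ z → B ^ R * suc R * z) Ry≡s+δ ⟩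
  B ^ R * suc R * (s + δ)          ≡⟨ e₁ R s δ (B ^ R) ⟩
  B * B ^ R + suc R * B ^ R * δ    ≤⟨ tangent≤^ B δ R ⟩
  (δ + B) ^ suc R                  ≡⟨ cong (_^ suc R) A≡δ+B ⟨
  (R * (s + y)) ^ suc R            ∎
  where
  open ≤-Reasoning
  δ = R * y ∸ s
  B = suc R * s
  Ry≡s+δ : R * y ≡ s + δ
  Ry≡s+δ = sym (m+[n∸m]≡n s≤Ry)
  e₀ : ∀ R s δ → R * s + (s + δ) ≡ δ + suc R * s
  e₀ = solve-∀
  A≡δ+B : R * (s + y) ≡ δ + B
  A≡δ+B = trans (*-distribˡ-+ R s y) (trans (cong (R * s +_) Ry≡s+δ) (e₀ R s δ))
  e₁ : ∀ R s δ P → P * suc R * (s + δ) ≡ suc R * s * P + suc R * P * δ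
  e₁ = solve-∀
... | inj₂ Ry≤s = +-cancelʳ-≤ (suc R * P * δ) _ _ (begin
  P * suc R * (R * y) + suc R * P * δ   ≡⟨ e₁ R y δ P ⟩
  suc R * (R * y + δ) * P               ≡⟨ cong (λ z → suc R * z * P) s≡Ry+δ ⟨
  B * P                                 ≡⟨ cong (λ z → B * z ^ R) B≡δ+A ⟩
  B * (δ + A) ^ R                       ≡⟨ cong (_* (δ + A) ^ R) B≡δ+A ⟩
  (δ + A) ^ suc R                       ≤⟨ ^≤tangent A δ R ⟩
  A ^ suc R + suc R * (δ + A) ^ R * δ   ≡⟨ cong (λ z → A ^ suc R + suc R * z ^ R * δ) B≡δ+A ⟨
  A ^ suc R + suc R * P * δ             ∎)
  where
  open ≤-Reasoning
  δ = s ∸ R * y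
  A = R * (s + y)
  B = suc R * s
  P = B ^ R
  s≡Ry+δ : s ≡ R * y + δ
  s≡Ry+δ = sym (m+[n∸m]≡n Ry≤s)
  e₀ : ∀ R y δ → suc R * (R * y + δ) ≡ δ + R * (R * y + δ + y)
  e₀ = solve-∀
  B≡δ+A : B ≡ δ + A
  B≡δ+A = trans (cong (suc R *_) s≡Ry+δ) (trans (e₀ R y δ) (cong (λ z → δ + R * (z + y)) (sym s≡Ry+δ)))
  e₁ : ∀ R y δ P → P * suc R * (R * y) + suc R * P * δ ≡ suc R * (R * y + δ) * P
  e₁ = solve-∀

-- For fixed s + y, s ^ R * y is largest when s = R * y.
amgm-step : ∀ R s y → suc R ^ suc R * s ^ R * y ≤ R ^ R * (s + y) ^ suc R
amgm-step zero    s y = begin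
  1 * 1 * 1 * y        ≡⟨ e₁ y ⟩
  y                    ≤⟨ m≤n+m y s ⟩
  s + y                ≡⟨ e₂ s y ⟩
  1 * ((s + y) * 1)    ∎
  where
  open ≤-Reasoning
  e₁ : ∀ y → 1 * 1 * 1 * y ≡ y
  e₁ = solve-∀
  e₂ : ∀ s y → s + y ≡ 1 * ((s + y) * 1)
  e₂ = solve-∀
amgm-step R@(suc _) s y = *-cancelˡ-≤ R (begin
  R * (suc R ^ suc R * s ^ R * y)       ≡⟨ e R (suc R ^ R) (s ^ R) y ⟩
  suc R ^ R * s ^ R * suc R * (R * y)   ≡⟨ cong (λ z → z * suc R * (R * y)) (^-distrib-* (suc R) s R) ⟨
  (suc R * s) ^ R * suc R * (R * y)     ≤⟨ amgm-step-scaled R s y ⟩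
  (R * (s + y)) ^ suc R                 ≡⟨ ^-distrib-* R (s + y) (suc R) ⟩
  R * R ^ R * (s + y) ^ suc R           ≡⟨ *-assoc R (R ^ R) _ ⟩
  R * (R ^ R * (s + y) ^ suc R)         ∎)
  where
  open ≤-Reasoning
  e : ∀ R P Q y → R * (suc R * P * Q * y) ≡ P * Q * suc R * (R * y)
  e = solve-∀

amgm : ∀ {k} (a : Fin k → ℕ) →
       nonzeroCount a ^ nonzeroCount a * nonzeroProduct a ≤ sum a ^ nonzeroCount a
amgm {zero}  a = ≤-refl
amgm {suc k} a with a zero
... | zero  = subst (_≤ sum (a ∘ suc) ^ R) (cong (R ^ R *_) (sym (+-identityʳ P))) (amgm (a ∘ suc))
  where
  R = nonzeroCount (a ∘ suc)
  P = nonzeroProduct (a ∘ suc)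
... | suc y = *-cancelˡ-≤ (R ^ R) {{≢-nonZero (>⇒≢ R^R>0)}} (begin
  R ^ R * (suc R ^ suc R * (suc y * P))   ≡⟨ e₁ (R ^ R) (suc R ^ suc R) (suc y) P ⟩
  suc R ^ suc R * suc y * (R ^ R * P)     ≤⟨ *-monoʳ-≤ (suc R ^ suc R * suc y) (amgm (a ∘ suc)) ⟩
  suc R ^ suc R * suc y * s ^ R           ≡⟨ e₂ (suc R ^ suc R) (suc y) (s ^ R) ⟩
  suc R ^ suc R * s ^ R * suc y           ≤⟨ amgm-step R s (suc y) ⟩
  R ^ R * (s + suc y) ^ suc R             ≡⟨ cong (λ z → R ^ R * z ^ suc R) (+-comm s (suc y)) ⟩
  R ^ R * (suc y + s) ^ suc R             ∎)
  where
  open ≤-Reasoning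
  R = nonzeroCount (a ∘ suc)
  P = nonzeroProduct (a ∘ suc)
  s = sum (a ∘ suc)
  R^R>0 : R ^ R > 0
  R^R>0 with R
  ... | zero  = ≤-refl
  ... | suc r = m^n>0 (suc r) (suc r)
  e₁ : ∀ A B c P → A * (B * (c * P)) ≡ B * c * (A * P)
  e₁ = solve-∀
  e₂ : ∀ B c S → B * c * S ≡ B * S * c
  e₂ = solve-∀

nonzeroProduct-≤ : ∀ {k} B (a : Fin k → ℕ) → (∀ j → a j ≤ B) → nonzeroProduct a ≤ B ^ nonzeroCount a
nonzeroProduct-≤ {zero}  B a a≤B = ≤-refl
nonzeroProduct-≤ {suc k} B a a≤B with a zero | a≤B zero
... | zero  | _      = subst (_≤ B ^ nonzeroCount (a ∘ suc)) (sym (+-identityʳ _)) rest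
  where rest = nonzeroProduct-≤ B (a ∘ suc) (a≤B ∘ suc)
... | suc y | a₀≤B = *-mono-≤ a₀≤B (nonzeroProduct-≤ B (a ∘ suc) (a≤B ∘ suc))

-- The product is at most R ^ R, and by AM–GM at most (n / R) ^ R.
nonzeroProduct²-≤ : ∀ {k} n (a : Fin k → ℕ) → (∀ j → a j ≤ nonzeroCount a) → sum a ≤ n →
                    nonzeroProduct a * nonzeroProduct a ≤ n ^ nonzeroCount a
nonzeroProduct²-≤ n a a≤R Σa≤n = begin
  nonzeroProduct a * nonzeroProduct a   ≤⟨ *-monoˡ-≤ (nonzeroProduct a) (nonzeroProduct-≤ R a a≤R) ⟩
  R ^ R * nonzeroProduct a              ≤⟨ amgm a ⟩
  sum a ^ R                             ≤⟨ ^-monoˡ-≤ R Σa≤n ⟩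
  n ^ R                                 ∎
  where
  open ≤-Reasoning
  R = nonzeroCount a

-- Counting

indicator : ∀ {A : Set} → Dec A → ℕ
indicator a? = if does a? then 1 else 0

count : ∀ {n} {P : Fin n → Set} → Decidable P → ℕ
count P? = sum (λ x → indicator (P? x))

indicator-mono : ∀ {A B : Set} (a? : Dec A) (b? : Dec B) → (A → B) → indicator a? ≤ indicator b?
indicator-mono (yes a) (yes _) _   = ≤-refl
indicator-mono (yes a) (no ¬b) a⇒b = contradiction (a⇒b a) ¬b
indicator-mono (no _)  _       _   = z≤n

count-mono : ∀ {n} {P Q : Fin n → Set} (P? : Decidable P) (Q? : Decidable Q) →
             (∀ x → P x → Q x) → count P? ≤ count Q?
count-mono P? Q? P⇒Q = sum-mono-≤ λ x → indicator-mono (P? x) (Q? x) (P⇒Q x)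

count-cong : ∀ {n} {P Q : Fin n → Set} (P? : Decidable P) (Q? : Decidable Q) →
             (∀ x → P x → Q x) → (∀ x → Q x → P x) → count P? ≡ count Q?
count-cong P? Q? P⇒Q Q⇒P = ≤-antisym (count-mono P? Q? P⇒Q) (count-mono Q? P? Q⇒P)

count≤n : ∀ {n} {P : Fin n → Set} (P? : Decidable P) → count P? ≤ n
count≤n {zero}  P? = z≤n
count≤n {suc n} P? = +-mono-≤ (indicator≤1 (P? zero)) (count≤n (P? ∘ suc))
  where
  indicator≤1 : ∀ {A : Set} (a? : Dec A) → indicator a? ≤ 1
  indicator≤1 (yes _) = ≤-refl
  indicator≤1 (no _)  = z≤n

count-none : ∀ {n} {P : Fin n → Set} (P? : Decidable P) → (∀ x → ¬ P x) → count P? ≡ 0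
count-none {zero}  P? ¬P = refl
count-none {suc n} P? ¬P with P? zero
... | yes p = contradiction p (¬P zero)
... | no  _ = count-none (P? ∘ suc) (¬P ∘ suc)

count>0 : ∀ {n} {P : Fin n → Set} (P? : Decidable P) {x} → P x → 0 < count P?
count>0 {suc n} P? {zero} p with P? zero
... | yes _  = s≤s z≤n
... | no  ¬p = contradiction p ¬p
count>0 {suc n} P? {suc x} p = ≤-trans (count>0 (P? ∘ suc) p) (m≤n+m _ (indicator (P? zero)))

count-split : ∀ {n} {P Q : Fin n → Set} (P? : Decidable P) (Q? : Decidable Q) →
              count P? ≡ count (λ x → P? x ×-dec Q? x) + count (λ x → P? x ×-dec ¬? (Q? x))
count-split P? Q? = trans (sum-cong-≗ λ x → split (P? x) (Q? x))
  (∑-distrib-+ (λ x → indicator (P? x ×-dec Q? x)) (λ x → indicator (P? x ×-dec ¬? (Q? x))))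
  where
  split : ∀ {A B : Set} (a? : Dec A) (b? : Dec B) →
          indicator a? ≡ indicator (a? ×-dec b?) + indicator (a? ×-dec ¬? b?)
  split (yes _) (yes _) = refl
  split (yes _) (no _)  = refl
  split (no _)  _       = refl

count≤1 : ∀ {n} {P : Fin n → Set} (P? : Decidable P) → (∀ x y → P x → P y → x ≡ y) → count P? ≤ 1
count≤1 {zero}  P? unique = z≤n
count≤1 {suc n} P? unique with P? zero
... | yes p = ≤-reflexive (cong suc (count-none (P? ∘ suc) λ x px → Fin.0≢1+n (unique zero (suc x) p px)))
... | no  _ = count≤1 (P? ∘ suc) λ x y px py → Fin.suc-injective (unique (suc x) (suc y) px py)

count≤-injection : ∀ {n} {P : Fin n → Set} (P? : Decidable P) L (φ : Fin n → ℕ) →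
  (∀ x → P x → φ x < L) → (∀ x y → P x → P y → φ x ≡ φ y → x ≡ y) → count P? ≤ L
count≤-injection P? zero    φ φ<L φ-inj = ≤-reflexive (count-none P? λ x px → n≮0 (φ<L x px))
count≤-injection P? (suc L) φ φ<L φ-inj = begin
  count P?                 ≡⟨ count-split P? (λ x → φ x ≟ L) ⟩
  count hit? + count miss? ≤⟨ +-mono-≤ top rest ⟩
  1 + L                    ∎
  where
  open ≤-Reasoning
  hit? miss? : Decidable _
  hit?  x = P? x ×-dec φ x ≟ L
  miss? x = P? x ×-dec ¬? (φ x ≟ L)
  top : count hit? ≤ 1
  top = count≤1 hit? λ { x y (px , φx≡L) (py , φy≡L) → φ-inj x y px py (trans φx≡L (sym φy≡L)) }
  rest : count miss? ≤ L
  rest = count≤-injection miss? L φ (λ { x (px , φx≢L) → ≤∧≢⇒< (≤-pred (φ<L x px)) φx≢L })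
                                    (λ { x y (px , _) (py , _) → φ-inj x y px py })

≤count-injection : ∀ {n L} {P : Fin n → Set} (P? : Decidable P) (ψ : Fin L → Fin n) →
  (∀ v → P (ψ v)) → (∀ v w → ψ v ≡ ψ w → v ≡ w) → L ≤ count P?
≤count-injection {L = zero}  P? ψ Pψ ψ-inj = z≤n
≤count-injection {L = suc L} P? ψ Pψ ψ-inj = begin
  1 + L                     ≤⟨ +-mono-≤ (count>0 hit? (Pψ zero , refl)) rest ⟩
  count hit? + count miss?  ≡⟨ count-split P? (Fin._≟ ψ zero) ⟨
  count P?                  ∎
  where
  open ≤-Reasoning
  hit? miss? : Decidable _
  hit?  x = P? x ×-dec x Fin.≟ ψ zero
  miss? x = P? x ×-dec ¬? (x Fin.≟ ψ zero)
  rest : L ≤ count miss?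
  rest = ≤count-injection miss? (ψ ∘ suc)
    (λ v → Pψ (suc v) , λ ψv≡ψ0 → Fin.0≢1+n (sym (ψ-inj (suc v) zero ψv≡ψ0)))
    (λ v w ψv≡ψw → Fin.suc-injective (ψ-inj (suc v) (suc w) ψv≡ψw))

count-fibres : ∀ {n k} (f : Fin n → Fin k) {P : Fin n → Set} (P? : Decidable P) →
               sum (λ j → count (λ x → f x Fin.≟ j ×-dec P? x)) ≡ count P?
count-fibres f P? = trans (∑-comm (λ j x → indicator (f x Fin.≟ j ×-dec P? x)))
                           (sum-cong-≗ λ x → fibre (f x) (P? x))
  where
  fibre : ∀ {k} {A : Set} (i : Fin k) (a? : Dec A) →
          sum (λ j → indicator (i Fin.≟ j ×-dec a?)) ≡ indicator a?
  fibre {suc k} zero    a? = trans (cong (indicator a? +_) (sum-replicate-zero k)) (+-identityʳ _)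
  fibre {suc k} (suc i) a? = fibre i a?

-- Subsets and set systems

∣p∣≡count : ∀ {n} (p : Subset n) → ∣ p ∣ ≡ count (_∈? p)
∣p∣≡count []          = refl
∣p∣≡count (true ∷ p)  = cong suc (∣p∣≡count p)
∣p∣≡count (false ∷ p) = ∣p∣≡count p

toSubset : ∀ {n} {P : Fin n → Set} → Decidable P → Subset n
toSubset P? = tabulate (λ x → does (P? x))

∈-toSubset⁺ : ∀ {n} {P : Fin n → Set} (P? : Decidable P) {x} → P x → x ∈ toSubset P?
∈-toSubset⁺ P? {x} px =
  lookup⇒[]= x (toSubset P?) (trans (lookup∘tabulate (λ y → does (P? y)) x) (dec-true (P? x) px))

∈-toSubset⁻ : ∀ {n} {P : Fin n → Set} (P? : Decidable P) {x} → x ∈ toSubset P? → P x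
∈-toSubset⁻ P? {x} x∈ with P? x | trans (sym (lookup∘tabulate (λ y → does (P? y)) x)) ([]=⇒lookup x∈)
... | yes px | _  = px
... | no  _  | ()

gain≡count : ∀ {n m} (S : SetSystem n m) C i → gain S C i ≡ count (λ x → x ∈? S i ×-dec ¬? (x ∈? C))
gain≡count S C i = trans (∣p∣≡count (S i ∩ ∁ C))
  (count-cong (_∈? S i ∩ ∁ C) (λ x → x ∈? S i ×-dec ¬? (x ∈? C))
    (λ x x∈ → let x∈Si , x∈∁C = x∈p∩q⁻ (S i) (∁ C) x∈ in x∈Si , x∈∁p⇒x∉p x∈∁C)
    (λ { x (x∈Si , x∉C) → x∈p∩q⁺ (x∈Si , x∉p⇒x∈∁p x∉C) }))

gain-mono : ∀ {n m} (S : SetSystem n m) C i l → gain S (S i ∪ C) l ≤ gain S C l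
gain-mono S C i l = p⊆q⇒∣p∣≤∣q∣ λ x∈ → let x∈Sl , x∈∁ = x∈p∩q⁻ (S l) _ x∈ in
  x∈p∩q⁺ (x∈Sl , x∉p⇒x∈∁p (x∈∁p⇒x∉p x∈∁ ∘ q⊆p∪q (S i) C))

gain-chosen : ∀ {n m} (S : SetSystem n m) C i → gain S (S i ∪ C) i ≡ 0
gain-chosen {n} S C i = trans (cong ∣_∣ (Empty-unique λ (x , x∈) → let x∈Si , x∈∁ = x∈p∩q⁻ (S i) _ x∈ in
  x∈∁p⇒x∉p x∈∁ (p⊆p∪q C x∈Si))) (∣⊥∣≡0 n)

∈-unionOf⁻ : ∀ {n m} (S : SetSystem n m) (is : List (Fin m)) {x} → x ∈ unionOf S is →
             ∃ λ (j : Fin (length is)) → x ∈ S (List.lookup is j)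
∈-unionOf⁻ S []       x∈ = contradiction x∈ ∉⊥
∈-unionOf⁻ S (i ∷ is) x∈ with x∈p∪q⁻ (S i) (unionOf S is) x∈
... | inj₁ x∈Si   = zero , x∈Si
... | inj₂ x∈rest = let j , x∈Sj = ∈-unionOf⁻ S is x∈rest in suc j , x∈Sj

∈-unionOf⁺ : ∀ {n m} (S : SetSystem n m) {is : List (Fin m)} {i x} →
             i ∈ₗ is → x ∈ S i → x ∈ unionOf S is
∈-unionOf⁺ S {i ∷ is} (here refl)  x∈Si = p⊆p∪q (unionOf S is) x∈Si
∈-unionOf⁺ S {j ∷ is} (there i∈is) x∈Si = q⊆p∪q (S j) (unionOf S is) (∈-unionOf⁺ S i∈is x∈Si)

-- The sets S (opt j) form an optimal cover, and every element x is assigned to the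
-- member S (opt (owner x)) containing it.  The uncovered elements assigned to
-- S (opt j) form the set A_j of size remaining C j.
module GreedyUpperBound {n m : ℕ} (S : SetSystem n m) (simple : Simple S) {k : ℕ}
  (opt : Fin k → Fin m) (owner : Fin n → Fin k) (∈-owner : ∀ x → x ∈ S (opt (owner x))) where

  remaining? : ∀ C j → Decidable (λ x → owner x ≡ j × x ∉ C)
  remaining? C j x = owner x Fin.≟ j ×-dec ¬? (x ∈? C)

  uncoveredIn? : ∀ C i → Decidable (λ x → x ∈ S i × x ∉ C)
  uncoveredIn? C i x = x ∈? S i ×-dec ¬? (x ∈? C)

  remaining : Subset n → Fin k → ℕ
  remaining C j = count (remaining? C j)

  newlyCovered? : ∀ C i j → Decidable (λ x → owner x ≡ j × x ∈ S i × x ∉ C)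
  newlyCovered? C i j x = owner x Fin.≟ j ×-dec uncoveredIn? C i x

  newlyCovered : Subset n → Fin m → Fin k → ℕ
  newlyCovered C i j = count (newlyCovered? C i j)

  sum-newlyCovered : ∀ C i → sum (newlyCovered C i) ≡ gain S C i
  sum-newlyCovered C i = trans (count-fibres owner (uncoveredIn? C i)) (sym (gain≡count S C i))

  sum-remaining≤n : ∀ C → sum (remaining C) ≤ n
  sum-remaining≤n C = ≤-trans (≤-reflexive (count-fibres owner uncovered?)) (count≤n uncovered?)
    where
    uncovered? : Decidable (_∉ C)
    uncovered? x = ¬? (x ∈? C)

  remaining-split : ∀ C i j → remaining C j ≡ newlyCovered C i j + remaining (S i ∪ C) j
  remaining-split C i j = trans (count-split (remaining? C j) (_∈? S i)) (cong₂ _+_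
    (count-cong (λ x → remaining? C j x ×-dec x ∈? S i) (newlyCovered? C i j)
      (λ { x ((o , x∉C) , x∈Si) → o , x∈Si , x∉C })
      (λ { x (o , x∈Si , x∉C) → (o , x∉C) , x∈Si }))
    (count-cong (λ x → remaining? C j x ×-dec ¬? (x ∈? S i)) (remaining? (S i ∪ C) j)
      (λ { x ((o , x∉C) , x∉Si) → o , [ x∉Si , x∉C ]′ ∘ x∈p∪q⁻ (S i) C })
      (λ { x (o , x∉Si∪C) → (o , x∉Si∪C ∘ q⊆p∪q (S i) C) , x∉Si∪C ∘ p⊆p∪q C })))

  remaining-mono : ∀ C i j → remaining (S i ∪ C) j ≤ remaining C j
  remaining-mono C i j = ≤-trans (m≤n+m _ (newlyCovered C i j)) (≤-reflexive (sym (remaining-split C i j)))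

  remaining≤gain : ∀ C j → remaining C j ≤ gain S C (opt j)
  remaining≤gain C j = subst (remaining C j ≤_) (sym (gain≡count S C (opt j)))
    (count-mono (remaining? C j) (uncoveredIn? C (opt j)) λ { x (refl , x∉C) → ∈-owner x , x∉C })

  remaining-owner>0 : ∀ C x → x ∉ C → 0 < remaining C (owner x)
  remaining-owner>0 C x x∉C = count>0 (remaining? C (owner x)) (refl , x∉C)

  -- This is where simplicity is used.
  newlyCovered≤1 : ∀ C i j → opt j ≢ i → newlyCovered C i j ≤ 1 ⊓ remaining C j
  newlyCovered≤1 C i j oj≢i = subst (newlyCovered C i j ≤_) (⊓-comm (remaining C j) 1) (⊓-glb
    (≤-trans (m≤m+n _ _) (≤-reflexive (sym (remaining-split C i j))))
    (begin
      newlyCovered C i j           ≤⟨ count-mono (newlyCovered? C i j) (_∈? S (opt j) ∩ S i)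
                                        (λ { x (refl , x∈Si , _) → x∈p∩q⁺ (∈-owner x , x∈Si) }) ⟩
      count (_∈? S (opt j) ∩ S i)  ≡⟨ ∣p∣≡count (S (opt j) ∩ S i) ⟨
      ∣ S (opt j) ∩ S i ∣          ≤⟨ simple (opt j) i oj≢i ⟩
      1                            ∎))
    where open ≤-Reasoning

  Greedy : Subset n → Fin m → Set
  Greedy C i = ∀ l → gain S C l ≤ gain S C i

  EmptiesNone : Subset n → Fin m → Set
  EmptiesNone C i = ∀ j → 0 < remaining C j → 0 < remaining (S i ∪ C) j

  remaining≤greedy-gain : ∀ C i → Greedy C i → ∀ j → remaining C j ≤ gain S C i
  remaining≤greedy-gain C i greedy j = ≤-trans (remaining≤gain C j) (greedy (opt j))

  greedy-gain>0 : ∀ C i → Nonempty (∁ C) → Greedy C i → 0 < gain S C i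
  greedy-gain>0 C i (x , x∈∁C) greedy =
    ≤-trans (remaining-owner>0 C x (x∈∁p⇒x∉p x∈∁C)) (remaining≤greedy-gain C i greedy (owner x))

  active : Subset n → ℕ
  active C = nonzeroCount (remaining C)

  activeOpt : Subset n → ℕ
  activeOpt C = nonzeroCount (λ j → gain S C (opt j))

  potential : Subset n → ℕ
  potential C = nonzeroProduct (remaining C)

  potential² : Subset n → ℕ
  potential² C = potential C * potential C

  active-mono : ∀ C i → active (S i ∪ C) ≤ active C
  active-mono C i = sum-mono-≤ λ j → ⊓-monoʳ-≤ 1 (remaining-mono C i j)

  active-drop : ∀ C i j → 0 < remaining C j → remaining (S i ∪ C) j ≡ 0 → active (S i ∪ C) < active C
  active-drop C i j 0<a a′≡0 = sum-mono-< (λ j → ⊓-monoʳ-≤ 1 (remaining-mono C i j)) j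
    (subst₂ _<_ (cong (1 ⊓_) (sym a′≡0)) (sym (m≤n⇒m⊓n≡m 0<a)) (s≤s z≤n))

  potential²-mono : ∀ C i → potential² (S i ∪ C) ≤ potential² C
  potential²-mono C i = *-mono-≤ Φ′≤Φ Φ′≤Φ
    where
    Φ′≤Φ = product-mono-≤ λ j → ⊔-monoʳ-≤ 1 (remaining-mono C i j)

  -- A_j loses newlyCovered C i j of its at most d = suc p elements, and these losses add up to d.
  potential-step : ∀ C i p → gain S C i ≡ suc p → EmptiesNone C i → (∀ j → remaining C j ≤ gain S C i) →
                   suc p ^ suc p * potential (S i ∪ C) ≤ p ^ suc p * potential C
  potential-step C i p gain≡d stays ≤gain = begin
    d ^ d * potential C′                     ≡⟨ cong (λ z → d ^ z * potential C′) Σc≡d ⟨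
    d ^ sum c * potential C′                 ≡⟨ cong (_* potential C′) (product-^ d c) ⟨
    product (λ j → d ^ c j) * potential C′   ≡⟨ product-distrib-* (λ j → d ^ c j) (a C′) ⟨
    product (λ j → d ^ c j * a C′ j)         ≤⟨ product-mono-≤ factor ⟩
    product (λ j → p ^ c j * a C j)          ≡⟨ product-distrib-* (λ j → p ^ c j) (a C) ⟩
    product (λ j → p ^ c j) * potential C    ≡⟨ cong (_* potential C) (product-^ p c) ⟩
    p ^ sum c * potential C                  ≡⟨ cong (λ z → p ^ z * potential C) Σc≡d ⟩
    p ^ d * potential C                      ∎
    where
    open ≤-Reasoning
    d = suc p
    C′ = S i ∪ C
    c = newlyCovered C i
    a : Subset n → Fin k → ℕ
    a D j = 1 ⊔ remaining D j
    Σc≡d : sum c ≡ d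
    Σc≡d = trans (sum-newlyCovered C i) gain≡d
    factor : ∀ j → d ^ c j * a C′ j ≤ p ^ c j * a C j
    factor j = subst (λ r → d ^ c j * a C′ j ≤ p ^ c j * (1 ⊔ r)) (sym (remaining-split C i j))
      (shrink-≤ p (c j) (remaining C′ j)
        (λ 0<a → stays j (subst (0 <_) (sym (remaining-split C i j)) 0<a))
        (subst (_≤ d) (remaining-split C i j) (subst (remaining C j ≤_) gain≡d (≤gain j))))

  -- A pick of gain d ≥ 2 emptying no A_j multiplies the potential by at most (1 - 1 / d) ^ d ≤ 1 / e.
  ExpLe-emptiesNone : ∀ C i {x} → Nonempty (∁ C) → Greedy C i → EmptiesNone C i →
                      ExpLe x (potential² (S i ∪ C)) → ExpLe (2 + x) (potential² C)
  ExpLe-emptiesNone C i nonempty greedy stays e^x≤ with gain S C i in gain≡ | greedy-gain>0 C i nonempty greedy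
  -- A pick of gain 1 always empties some A_j.
  ... | suc zero    | _ = contradiction (potential-step C i 0 gain≡ stays (remaining≤greedy-gain C i greedy))
                                        (<⇒≱ (≤-trans (nonzeroProduct>0 (remaining (S i ∪ C))) (m≤m+n _ 0)))
  ... | suc (suc p) | _ = ExpLe-+ (suc p) 2 {M = potential² (S i ∪ C)} {N = potential² C}
    (subst₂ _≤_ (e (d ^ d) (potential (S i ∪ C))) (e (suc p ^ d) (potential C)) (*-mono-≤ step₁ step₁))
    e^x≤
    where
    d = suc (suc p)
    step₁ = potential-step C i (suc p) gain≡ stays (remaining≤greedy-gain C i greedy)
    e : ∀ Y a → Y * a * (Y * a) ≡ Y * (Y * 1) * (a * a)
    e = solve-∀

  ExpLe-after : ∀ C G → GreedyFrom S C G → ExpLe (2 * (length G ∸ active C)) (potential² C)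
  ExpLe-after C [] (done _) = ExpLe-mono {M = potential² C} (≤-reflexive (cong (2 *_) (0∸n≡0 (active C)))) ≤-refl
    (ExpLe-zero (*-mono-≤ (nonzeroProduct>0 (remaining C)) (nonzeroProduct>0 (remaining C))))
  ExpLe-after C (i ∷ G) (step nonempty greedy run)
    with any? (λ j → (0 <? remaining C j) ×-dec (remaining (S i ∪ C) j ≟ 0))
  ... | yes (j , 0<a , a′≡0) = ExpLe-mono {M = potential² (S i ∪ C)}
    (*-monoʳ-≤ 2 (∸-monoʳ-≤ (suc (length G)) (active-drop C i j 0<a a′≡0)))
    (potential²-mono C i) (ExpLe-after (S i ∪ C) G run)
  ... | no none-emptied = ExpLe-mono {M = potential² C} exponent ≤-refl
    (ExpLe-emptiesNone C i nonempty greedy (λ j 0<a → n≢0⇒n>0 λ a′≡0 → none-emptied (j , 0<a , a′≡0))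
      (ExpLe-after (S i ∪ C) G run))
    where
    open ≤-Reasoning
    L = length G
    r′ = active (S i ∪ C)
    exponent : 2 * (suc L ∸ active C) ≤ 2 + 2 * (L ∸ r′)
    exponent = begin
      2 * (suc L ∸ active C)   ≤⟨ *-monoʳ-≤ 2 (∸-monoʳ-≤ (suc L) (active-mono C i)) ⟩
      2 * (suc L ∸ r′)         ≤⟨ *-monoʳ-≤ 2 (suc-∸-≤ L r′) ⟩
      2 * suc (L ∸ r′)         ≡⟨ *-suc 2 (L ∸ r′) ⟩
      2 + 2 * (L ∸ r′)         ∎

  active≤activeOpt : ∀ C → active C ≤ activeOpt C
  active≤activeOpt C = sum-mono-≤ λ j → ⊓-monoʳ-≤ 1 (remaining≤gain C j)

  -- Once greedy picks a set outside the optimal cover, its gain bounds every A_j,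
  -- and it meets at most active C of them.
  potential²≤ : ∀ C i → (∀ j → opt j ≢ i) → Greedy C i → potential² C ≤ n ^ active C
  potential²≤ C i ¬opt greedy = nonzeroProduct²-≤ n (remaining C) remaining≤active (sum-remaining≤n C)
    where
    open ≤-Reasoning
    remaining≤active : ∀ j → remaining C j ≤ active C
    remaining≤active j = begin
      remaining C j            ≤⟨ remaining≤greedy-gain C i greedy j ⟩
      gain S C i               ≡⟨ sum-newlyCovered C i ⟨
      sum (newlyCovered C i)   ≤⟨ sum-mono-≤ (λ l → newlyCovered≤1 C i l (¬opt l)) ⟩
      active C                 ∎

  activeOpt-covered : ∀ C → (∀ x → x ∈ C) → activeOpt C ≡ 0
  activeOpt-covered C all∈C = trans (sum-cong-≗ λ j → cong (1 ⊓_) (no-gain (opt j))) (sum-replicate-zero k)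
    where
    no-gain : ∀ l → gain S C l ≡ 0
    no-gain l = trans (gain≡count S C l) (count-none (uncoveredIn? C l) λ x (_ , x∉C) → x∉C (all∈C x))

  activeOpt-drop : ∀ C j → Nonempty (∁ C) → Greedy C (opt j) → activeOpt (S (opt j) ∪ C) < activeOpt C
  activeOpt-drop C j nonempty greedy = sum-mono-< (λ l → ⊓-monoʳ-≤ 1 (gain-mono S C (opt j) (opt l))) j
    (subst₂ _<_ (cong (1 ⊓_) (sym (gain-chosen S C (opt j))))
                (sym (m≤n⇒m⊓n≡m (greedy-gain>0 C (opt j) nonempty greedy))) (s≤s z≤n))

  ExpLe-before : ∀ C G → GreedyFrom S C G → ExpLe (2 * (length G ∸ activeOpt C)) (n ^ activeOpt C)
  ExpLe-before C [] (done all∈C) = ExpLe-mono {M = n ^ activeOpt C}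
    (≤-reflexive (cong (2 *_) (0∸n≡0 (activeOpt C)))) ≤-refl
    (ExpLe-zero (subst (λ r → 1 ≤ n ^ r) (sym (activeOpt-covered C all∈C)) ≤-refl))
  ExpLe-before C (i ∷ G) (step nonempty greedy run) with any? (λ j → opt j Fin.≟ i)
  ... | yes (j , refl) = ExpLe-mono {M = n ^ activeOpt (S i ∪ C)}
    (*-monoʳ-≤ 2 (∸-monoʳ-≤ (suc (length G)) drop))
    (^-monoʳ-≤ n {{Fin.nonZeroIndex (proj₁ nonempty)}} (≤-trans (n≤1+n _) drop))
    (ExpLe-before (S i ∪ C) G run)
    where
    drop = activeOpt-drop C j nonempty greedy
  ... | no ¬opt = ExpLe-mono {M = potential² C}
    (*-monoʳ-≤ 2 (∸-monoʳ-≤ (suc (length G)) (active≤activeOpt C)))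
    (≤-trans (potential²≤ C i (λ j oj≡i → ¬opt (j , oj≡i)) greedy)
             (^-monoʳ-≤ n {{Fin.nonZeroIndex (proj₁ nonempty)}} (active≤activeOpt C)))
    (ExpLe-after C (i ∷ G) (step nonempty greedy run))

greedy-upper-bound : ∀ {n m} (S : SetSystem n m) → Simple S → ∀ {opt} → IsOptimum S opt →
                     ∀ {G} → GreedyRun S G → ExpLe (2 * (length G ∸ opt)) (n ^ opt)
greedy-upper-bound {n} S simple {opt} ((os , os-covers , os-length) , minimal) {G} run =
  ExpLe-mono {M = n ^ activeOpt ∅} (*-monoʳ-≤ 2 (∸-monoʳ-≤ (length G) r≤opt))
    -- For n = 0 the empty list is a cover, so opt = 0.
    (^-monoʳ-≤′ n r≤opt λ n≡0 → ≤-trans (minimal [] (λ x → contradiction (subst Fin n≡0 x) Fin.¬Fin0)) z≤n)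
    (ExpLe-before ∅ G run)
  where
  owner : Fin n → Fin (length os)
  owner x = proj₁ (∈-unionOf⁻ S os (os-covers x))
  open GreedyUpperBound S simple (List.lookup os) owner (λ x → proj₂ (∈-unionOf⁻ S os (os-covers x)))
  r≤opt : activeOpt ∅ ≤ opt
  r≤opt = subst (activeOpt ∅ ≤_) os-length (nonzeroCount≤ (λ j → gain S ∅ (List.lookup os j)))

-- The universe is the k × k grid, the point p < k * k lying in row p / k and
-- column p % k.  The optimal cover consists of the k columns; greedy instead takes
-- the chunks [front t, front (suc t)) of consecutive points, chunk t being as long
-- as the number k ∸ front t / k of rows not yet entered.
module GreedyLowerBound (a : ℕ) where

  k : ℕ
  k = suc (suc a)

  instance
    k≢0 : NonZero k
    k≢0 = _

  kk : ℕ
  kk = k * k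

  width : ℕ → ℕ
  front : ℕ → ℕ
  width t = k ∸ front t / k
  front zero    = 0
  front (suc t) = front t + width t

  p/k<k : ∀ {p} → p < kk → p / k < k
  p/k<k = m<n*o⇒m/o<n

  -- With p = r + c k and k = suc (c + d): r + c k + (k ∸ c) ≤ (c + 1) k + d ≤ k * k.
  +width≤kk : ∀ p → p < kk → p + (k ∸ p / k) ≤ kk
  +width≤kk p p<kk = begin
    p + (k ∸ c)                                        ≡⟨ cong (_+ (k ∸ c)) (m≡m%n+[m/n]*n p k) ⟩
    r + c * k + (k ∸ c)                                ≡⟨ cong (λ z → r + c * k + (z ∸ c)) k≡ ⟩
    r + c * k + (suc (c + d) ∸ c)                      ≡⟨ cong (r + c * k +_) k∸c≡ ⟩
    r + c * k + suc d                                  ≡⟨ cong (λ z → r + c * z + suc d) k≡ ⟩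
    r + c * suc (c + d) + suc d                        ≤⟨ +-monoˡ-≤ (suc d) (+-monoˡ-≤ _ r≤c+d) ⟩
    c + d + c * suc (c + d) + suc d                    ≤⟨ m≤m+n _ (d * d + c * d) ⟩
    c + d + c * suc (c + d) + suc d + (d * d + c * d)  ≡⟨ e c d ⟩
    suc (c + d) * suc (c + d)                          ≡⟨ cong₂ _*_ k≡ k≡ ⟨
    kk                                                 ∎
    where
    open ≤-Reasoning
    c = p / k
    r = p % k
    d = suc a ∸ c
    k≡ : k ≡ suc (c + d)
    k≡ = cong suc (sym (m+[n∸m]≡n (≤-pred (p/k<k p<kk))))
    k∸c≡ : suc (c + d) ∸ c ≡ suc d
    k∸c≡ = trans (+-∸-assoc 1 (m≤m+n c d)) (cong suc (m+n∸m≡n c d))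
    r≤c+d : r ≤ c + d
    r≤c+d = ≤-pred (subst (r <_) k≡ (m%n<n p k))
    e : ∀ c d → c + d + c * suc (c + d) + suc d + (d * d + c * d) ≡ suc (c + d) * suc (c + d)
    e = solve-∀

  front≤kk : ∀ t → front t ≤ kk
  front≤kk zero    = z≤n
  front≤kk (suc t) with m≤n⇒m<n∨m≡n (front≤kk t)
  ... | inj₁ front<kk = +width≤kk (front t) front<kk
  ... | inj₂ front≡kk = ≤-reflexive (begin-equality
    front t + (k ∸ front t / k)   ≡⟨ cong (λ f → f + (k ∸ f / k)) front≡kk ⟩
    kk + (k ∸ kk / k)             ≡⟨ cong (λ c → kk + (k ∸ c)) (m*n/n≡m k k) ⟩
    kk + (k ∸ k)                  ≡⟨ cong (kk +_) (n∸n≡0 k) ⟩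
    kk + 0                        ≡⟨ +-identityʳ kk ⟩
    kk                            ∎)
    where open ≤-Reasoning

  front-mono : ∀ {t u} → t ≤ u → front t ≤ front u
  front-mono {t} {u} t≤u with m≤n⇒m<n∨m≡n t≤u
  ... | inj₂ refl                = ≤-refl
  ... | inj₁ (s≤s {n = u₀} t≤u₀) = ≤-trans (front-mono t≤u₀) (m≤m+n (front u₀) (width u₀))

  width≤k : ∀ t → width t ≤ k
  width≤k t = m∸n≤m k (front t / k)

  width-anti : ∀ {t u} → t ≤ u → width u ≤ width t
  width-anti t≤u = ∸-monoʳ-≤ k (/-monoˡ-≤ k (front-mono t≤u))

  front<front-suc : ∀ t → front t < kk → front t < front (suc t)
  front<front-suc t front<kk = subst (_≤ front (suc t)) (+-comm (front t) 1)
    (+-monoʳ-≤ (front t) (m<n⇒0<n∸m (p/k<k front<kk)))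

  front-kk : front kk ≡ kk
  front-kk = ≤-antisym (front≤kk kk) (≮⇒≥ λ front<kk → <⇒≱ front<kk (grows kk front<kk))
    where
    grows : ∀ t → front t < kk → t ≤ front t
    grows zero    _        = z≤n
    grows (suc t) front<kk = ≤-trans (s≤s (grows t f<kk)) (front<front-suc t f<kk)
      where
      f<kk = ≤-<-trans (m≤m+n (front t) (width t)) front<kk

  -- The number T of chunks is the least t with front t ≡ kk.
  firstFull : ∃ λ (i : Fin (suc kk)) → ¬ front (toℕ i) < kk × ((j : Fin′ i) → front (toℕ (inject j)) < kk)
  firstFull = ¬∀⟶∃¬-smallest (suc kk) _ (λ i → front (toℕ i) <? kk)
    λ all<kk → <-irrefl (trans (cong front (Fin.toℕ-fromℕ kk)) front-kk) (all<kk (fromℕ kk))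

  T : ℕ
  T = toℕ (proj₁ firstFull)

  front-T : front T ≡ kk
  front-T = ≤-antisym (front≤kk T) (≮⇒≥ (proj₁ (proj₂ firstFull)))

  front<kk : ∀ {t} → t < T → front t < kk
  front<kk t<T = subst (λ u → front u < kk) (trans (Fin.toℕ-inject j) (Fin.toℕ-fromℕ< t<T))
                       (proj₂ (proj₂ firstFull) j)
    where
    j = fromℕ< t<T

  -- The sets of the system: the columns inj₁ i and the chunks inj₂ t.
  Block : Set
  Block = Fin k ⊎ Fin T

  infix 4 _∈ᵇ_ _∈ᵇ?_
  _∈ᵇ_ : ℕ → Block → Set
  p ∈ᵇ inj₁ i = p % k ≡ toℕ i
  p ∈ᵇ inj₂ t = front (toℕ t) ≤ p × p < front (suc (toℕ t))

  _∈ᵇ?_ : ∀ p b → Dec (p ∈ᵇ b)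
  p ∈ᵇ? inj₁ i = p % k ≟ toℕ i
  p ∈ᵇ? inj₂ t = front (toℕ t) ≤? p ×-dec p <? front (suc (toℕ t))

  chunk-short : ∀ {t p q} → p ∈ᵇ inj₂ t → q ∈ᵇ inj₂ t → q < p + k
  chunk-short {t} {p} (front≤p , _) (_ , q<front′) =
    ≤-trans q<front′ (≤-trans (+-monoʳ-≤ (front (toℕ t)) (width≤k (toℕ t))) (+-monoˡ-≤ k front≤p))

  column∩chunk-unique : ∀ {i t p q} → p ∈ᵇ inj₁ i → p ∈ᵇ inj₂ t →
                                      q ∈ᵇ inj₁ i → q ∈ᵇ inj₂ t → p ≡ q
  column∩chunk-unique {i} {t} {p} {q} p∈i p∈t q∈i q∈t with ≤-total p q
  ... | inj₁ p≤q = ≡-mod∧close⇒≡ k (trans p∈i (sym q∈i)) p≤q (chunk-short {t} p∈t q∈t)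
  ... | inj₂ q≤p = sym (≡-mod∧close⇒≡ k (trans q∈i (sym p∈i)) q≤p (chunk-short {t} q∈t p∈t))

  chunks-disjoint : ∀ {t u p} → p ∈ᵇ inj₂ t → p ∈ᵇ inj₂ u → toℕ t ≡ toℕ u
  chunks-disjoint {t} {u} (front-t≤p , p<front-t′) (front-u≤p , p<front-u′) with <-cmp (toℕ t) (toℕ u)
  ... | tri≈ _ t≡u _ = t≡u
  ... | tri< t<u _ _ = contradiction (≤-trans p<front-t′ (≤-trans (front-mono t<u) front-u≤p)) (<-irrefl refl)
  ... | tri> _ _ t>u = contradiction (≤-trans p<front-u′ (≤-trans (front-mono t>u) front-t≤p)) (<-irrefl refl)

  blocks-meet-once : ∀ {b b′} → b ≢ b′ → ∀ {p q} → p ∈ᵇ b → p ∈ᵇ b′ → q ∈ᵇ b → q ∈ᵇ b′ → p ≡ q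
  blocks-meet-once {inj₁ i} {inj₁ j} i≢j p∈i p∈j _ _ =
    contradiction (cong inj₁ (Fin.toℕ-injective (trans (sym p∈i) p∈j))) i≢j
  blocks-meet-once {inj₁ i} {inj₂ t} _ p∈i p∈t q∈i q∈t = column∩chunk-unique {i} {t} p∈i p∈t q∈i q∈t
  blocks-meet-once {inj₂ t} {inj₁ i} _ p∈t p∈i q∈t q∈i = column∩chunk-unique {i} {t} p∈i p∈t q∈i q∈t
  blocks-meet-once {inj₂ t} {inj₂ u} t≢u p∈t p∈u _ _ =
    contradiction (cong inj₂ (Fin.toℕ-injective (chunks-disjoint {t} {u} p∈t p∈u))) t≢u

  column-point : ∀ i c → toℕ i + c * k ∈ᵇ inj₁ i
  column-point i c = trans ([m+kn]%n≡m%n (toℕ i) c k) (m<n⇒m%n≡m (Fin.toℕ<n i))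

  column-point<kk : ∀ i c → c < k → toℕ i + c * k < kk
  column-point<kk i c c<k = ≤-trans (+-monoˡ-< (c * k) (Fin.toℕ<n i)) (*-monoˡ-≤ k c<k)

  front-point : ∀ t → front (toℕ t) ∈ᵇ inj₂ t
  front-point t = ≤-refl , front<front-suc (toℕ t) (front<kk (Fin.toℕ<n t))

  block? : ∀ b → Decidable (λ (x : Fin kk) → toℕ x ∈ᵇ b)
  block? b x = toℕ x ∈ᵇ? b

  block : Block → Subset kk
  block b = toSubset (block? b)

  shares-points : ∀ {b b′} → block b ≡ block b′ → ∀ {p} → p < kk → p ∈ᵇ b → p ∈ᵇ b′
  shares-points {b} {b′} eq {p} p<kk p∈b = subst (_∈ᵇ b′) (Fin.toℕ-fromℕ< p<kk)
    (∈-toSubset⁻ (block? b′) (subst (fromℕ< p<kk ∈_) eq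
      (∈-toSubset⁺ (block? b) (subst (_∈ᵇ b) (sym (Fin.toℕ-fromℕ< p<kk)) p∈b))))

  -- Both points toℕ i and toℕ i + k of the column would lie in the chunk.
  column≢chunk : ∀ {i t} → block (inj₁ i) ≢ block (inj₂ t)
  column≢chunk {i} {t} eq = contradiction (*-cancelʳ-≡ 0 1 k (+-cancelˡ-≡ (toℕ i) _ _
    (column∩chunk-unique {i} {t} (column-point i 0) (in-chunk 0 (s≤s z≤n))
                                 (column-point i 1) (in-chunk 1 (s≤s (s≤s z≤n)))))) λ ()
    where
    in-chunk : ∀ c → c < k → toℕ i + c * k ∈ᵇ inj₂ t
    in-chunk c c<k = shares-points {inj₁ i} {inj₂ t} eq (column-point<kk i c c<k) (column-point i c)

  block-injective : ∀ {b b′} → block b ≡ block b′ → b ≡ b′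
  block-injective {inj₁ i} {inj₁ j} eq = cong inj₁ (Fin.toℕ-injective (trans (sym (column-point i 0))
    (shares-points {inj₁ i} {inj₁ j} eq (column-point<kk i 0 (s≤s z≤n)) (column-point i 0))))
  block-injective {inj₁ i} {inj₂ t} eq = contradiction eq (column≢chunk {i} {t})
  block-injective {inj₂ t} {inj₁ i} eq = contradiction (sym eq) (column≢chunk {i} {t})
  block-injective {inj₂ t} {inj₂ u} eq = cong inj₂ (Fin.toℕ-injective (chunks-disjoint {t} {u} (front-point t)
    (shares-points {inj₂ t} {inj₂ u} eq (front<kk (Fin.toℕ<n t)) (front-point t))))

  system : SetSystem kk (k + T)
  system j = block (splitAt k j)

  column : Fin k → Fin (k + T)
  column i = i ↑ˡ T

  chunk : Fin T → Fin (k + T)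
  chunk t = k ↑ʳ t

  splitAt-injective : ∀ {j j′ : Fin (k + T)} → splitAt k j ≡ splitAt k j′ → j ≡ j′
  splitAt-injective {j} {j′} eq =
    trans (sym (Fin.join-splitAt k T j)) (trans (cong (join k T) eq) (Fin.join-splitAt k T j′))

  ∈-system⁻ : ∀ {j x} → x ∈ system j → toℕ x ∈ᵇ splitAt k j
  ∈-system⁻ {j} = ∈-toSubset⁻ (block? (splitAt k j))

  ∈-column : ∀ {i x} → toℕ x ∈ᵇ inj₁ i → x ∈ system (column i)
  ∈-column {i} {x} x∈i =
    ∈-toSubset⁺ (block? (splitAt k (column i))) (subst (toℕ x ∈ᵇ_) (sym (Fin.splitAt-↑ˡ k i T)) x∈i)

  ∈-chunk : ∀ {u x} → toℕ x ∈ᵇ inj₂ u → x ∈ system (chunk u)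
  ∈-chunk {u} {x} x∈u =
    ∈-toSubset⁺ (block? (splitAt k (chunk u))) (subst (toℕ x ∈ᵇ_) (sym (Fin.splitAt-↑ʳ k T u)) x∈u)

  system-distinct : Distinct system
  system-distinct j j′ eq = splitAt-injective (block-injective {splitAt k j} {splitAt k j′} eq)

  system-simple : Simple system
  system-simple j j′ j≢j′ = begin
    ∣ system j ∩ system j′ ∣          ≡⟨ ∣p∣≡count (system j ∩ system j′) ⟩
    count (_∈? system j ∩ system j′)  ≤⟨ count≤1 (_∈? system j ∩ system j′) unique ⟩
    1                                 ∎
    where
    open ≤-Reasoning
    unique : ∀ x y → x ∈ system j ∩ system j′ → y ∈ system j ∩ system j′ → x ≡ y
    unique x y x∈ y∈ =
      let x∈j , x∈j′ = x∈p∩q⁻ (system j) (system j′) x∈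
          y∈j , y∈j′ = x∈p∩q⁻ (system j) (system j′) y∈
      in Fin.toℕ-injective (blocks-meet-once (j≢j′ ∘ splitAt-injective)
           (∈-system⁻ {j} x∈j) (∈-system⁻ {j′} x∈j′) (∈-system⁻ {j} y∈j) (∈-system⁻ {j′} y∈j′))

  columnOf : Fin kk → Fin k
  columnOf x = fromℕ< (m%n<n (toℕ x) k)

  system-covers : CoversUniverse system
  system-covers x = column (columnOf x) , ∈-column (sym (Fin.toℕ-fromℕ< (m%n<n (toℕ x) k)))

  CoveredUpTo : Subset kk → ℕ → Set
  CoveredUpTo C t = ∀ x → (x ∈ C → toℕ x < front t) × (toℕ x < front t → x ∈ C)

  uncoveredIn? : ∀ t b → Decidable (λ (x : Fin kk) → toℕ x ∈ᵇ b × front t ≤ toℕ x)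
  uncoveredIn? t b x = toℕ x ∈ᵇ? b ×-dec front t ≤? toℕ x

  uncoveredIn : ℕ → Block → ℕ
  uncoveredIn t b = count (uncoveredIn? t b)

  gain≡uncoveredIn : ∀ {C} t j → CoveredUpTo C t → gain system C j ≡ uncoveredIn t (splitAt k j)
  gain≡uncoveredIn {C} t j covered = trans (gain≡count system C j)
    (count-cong (λ x → x ∈? system j ×-dec ¬? (x ∈? C)) (uncoveredIn? t (splitAt k j))
      (λ { x (x∈ , x∉C) → ∈-system⁻ {j} x∈ , ≮⇒≥ (x∉C ∘ proj₂ (covered x)) })
      (λ { x (x∈ , front≤x) → ∈-toSubset⁺ (block? (splitAt k j)) x∈ ,
                               λ x∈C → <⇒≱ (proj₁ (covered x) x∈C) front≤x }))

  column-uncovered≤ : ∀ t i → uncoveredIn t (inj₁ i) ≤ width t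
  column-uncovered≤ t i = count≤-injection (uncoveredIn? t (inj₁ i)) (width t) row bound injective
    where
    row : Fin kk → ℕ
    row x = toℕ x / k ∸ front t / k
    bound : ∀ x → toℕ x ∈ᵇ inj₁ i × front t ≤ toℕ x → row x < width t
    bound x (_ , front≤x) = ∸-monoˡ-< (p/k<k (Fin.toℕ<n x)) (/-monoˡ-≤ k front≤x)
    injective : ∀ x y → toℕ x ∈ᵇ inj₁ i × front t ≤ toℕ x →
                        toℕ y ∈ᵇ inj₁ i × front t ≤ toℕ y → row x ≡ row y → x ≡ y
    injective x y (x∈i , front≤x) (y∈i , front≤y) rx≡ry = Fin.toℕ-injective (begin-equality
      toℕ x                       ≡⟨ m≡m%n+[m/n]*n (toℕ x) k ⟩
      toℕ x % k + toℕ x / k * k   ≡⟨ cong₂ (λ r c → r + c * k) (trans x∈i (sym y∈i))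
                                       (∸-cancelʳ-≡ (/-monoˡ-≤ k front≤x) (/-monoˡ-≤ k front≤y) rx≡ry) ⟩
      toℕ y % k + toℕ y / k * k   ≡⟨ m≡m%n+[m/n]*n (toℕ y) k ⟨
      toℕ y                       ∎)
      where open ≤-Reasoning

  chunk-uncovered≤ : ∀ t u → uncoveredIn t (inj₂ u) ≤ width t
  chunk-uncovered≤ t u = count≤-injection (uncoveredIn? t (inj₂ u)) (width t) offset bound injective
    where
    offset : Fin kk → ℕ
    offset x = toℕ x ∸ front (toℕ u)
    bound : ∀ x → toℕ x ∈ᵇ inj₂ u × front t ≤ toℕ x → offset x < width t
    bound x ((front-u≤x , x<front-u′) , front≤x) with t ≤? toℕ u
    ... | yes t≤u = ≤-trans (∸-monoˡ-< x<front-u′ front-u≤x)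
                            (≤-trans (≤-reflexive (m+n∸m≡n (front (toℕ u)) (width (toℕ u)))) (width-anti t≤u))
    ... | no  t≰u = contradiction (≤-trans x<front-u′ (≤-trans (front-mono (≰⇒> t≰u)) front≤x)) (<-irrefl refl)
    injective : ∀ x y → toℕ x ∈ᵇ inj₂ u × front t ≤ toℕ x →
                        toℕ y ∈ᵇ inj₂ u × front t ≤ toℕ y → offset x ≡ offset y → x ≡ y
    injective x y ((front-u≤x , _) , _) ((front-u≤y , _) , _) ox≡oy =
      Fin.toℕ-injective (∸-cancelʳ-≡ front-u≤x front-u≤y ox≡oy)

  width≤chunk-uncovered : ∀ u → width (toℕ u) ≤ uncoveredIn (toℕ u) (inj₂ u)
  width≤chunk-uncovered u = ≤count-injection (uncoveredIn? t (inj₂ u)) point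
    (λ v → subst (λ p → p ∈ᵇ inj₂ u × front t ≤ p) (sym (Fin.toℕ-fromℕ< (point<kk v)))
                 ((m≤m+n (front t) (toℕ v) , +-monoʳ-< (front t) (Fin.toℕ<n v)) , m≤m+n (front t) (toℕ v)))
    (λ v w eq → Fin.toℕ-injective (+-cancelˡ-≡ (front t) (toℕ v) (toℕ w)
       (trans (sym (Fin.toℕ-fromℕ< (point<kk v))) (trans (cong toℕ eq) (Fin.toℕ-fromℕ< (point<kk w))))))
    where
    t = toℕ u
    point<kk : ∀ (v : Fin (width t)) → front t + toℕ v < kk
    point<kk v = ≤-trans (+-monoʳ-< (front t) (Fin.toℕ<n v)) (front≤kk (suc t))
    point : Fin (width t) → Fin kk
    point v = fromℕ< (point<kk v)

  greedy-picks-chunk : ∀ {C} u → CoveredUpTo C (toℕ u) → ∀ j → gain system C j ≤ gain system C (chunk u)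
  greedy-picks-chunk {C} u covered j = begin
    gain system C j                      ≡⟨ gain≡uncoveredIn t j covered ⟩
    uncoveredIn t (splitAt k j)          ≤⟨ uncovered≤width (splitAt k j) ⟩
    width t                              ≤⟨ width≤chunk-uncovered u ⟩
    uncoveredIn t (inj₂ u)               ≡⟨ cong (uncoveredIn t) (Fin.splitAt-↑ʳ k T u) ⟨
    uncoveredIn t (splitAt k (chunk u))  ≡⟨ gain≡uncoveredIn t (chunk u) covered ⟨
    gain system C (chunk u)              ∎
    where
    open ≤-Reasoning
    t = toℕ u
    uncovered≤width : ∀ b → uncoveredIn t b ≤ width t
    uncovered≤width (inj₁ i)  = column-uncovered≤ t i
    uncovered≤width (inj₂ u′) = chunk-uncovered≤ t u′

  covered-next : ∀ {C} u → CoveredUpTo C (toℕ u) → CoveredUpTo (system (chunk u) ∪ C) (suc (toℕ u))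
  covered-next {C} u covered x = before , after
    where
    t = toℕ u
    before : x ∈ system (chunk u) ∪ C → toℕ x < front (suc t)
    before x∈ with x∈p∪q⁻ (system (chunk u)) C x∈
    ... | inj₁ x∈u = proj₂ (subst (toℕ x ∈ᵇ_) (Fin.splitAt-↑ʳ k T u) (∈-system⁻ {chunk u} x∈u))
    ... | inj₂ x∈C = ≤-trans (proj₁ (covered x) x∈C) (m≤m+n (front t) (width t))
    after : toℕ x < front (suc t) → x ∈ system (chunk u) ∪ C
    after x<front′ with toℕ x <? front t
    ... | yes x<front = q⊆p∪q (system (chunk u)) C (proj₂ (covered x) x<front)
    ... | no  x≮front = p⊆p∪q C (∈-chunk {u} (≮⇒≥ x≮front , x<front′))

  uncovered-front : ∀ {C} t → CoveredUpTo C t → t < T → Nonempty (∁ C)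
  uncovered-front {C} t covered t<T =
    x , x∉p⇒x∈∁p λ x∈C → <-irrefl (Fin.toℕ-fromℕ< (front<kk t<T)) (proj₁ (covered x) x∈C)
    where
    x = fromℕ< (front<kk t<T)

  lastChunks : ∀ r → r ≤ T → List (Fin (k + T))
  lastChunks zero    _   = []
  lastChunks (suc r) r<T = chunk (fromℕ< (∸-monoʳ-< (s≤s z≤n) r<T)) ∷ lastChunks r (<⇒≤ r<T)

  length-lastChunks : ∀ r r≤T → length (lastChunks r r≤T) ≡ r
  length-lastChunks zero    _   = refl
  length-lastChunks (suc r) r<T = cong suc (length-lastChunks r (<⇒≤ r<T))

  lastChunks-greedy : ∀ r r≤T {C} → CoveredUpTo C (T ∸ r) → GreedyFrom system C (lastChunks r r≤T)
  lastChunks-greedy zero    _   covered =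
    done λ x → proj₂ (covered x) (subst (toℕ x <_) (sym front-T) (Fin.toℕ<n x))
  lastChunks-greedy (suc r) r<T {C} covered =
    step (uncovered-front (toℕ u) covered′ (subst (_< T) (sym t≡) (∸-monoʳ-< (s≤s z≤n) r<T)))
         (greedy-picks-chunk u covered′)
         (lastChunks-greedy r (<⇒≤ r<T) (subst (CoveredUpTo _) suc-t≡ (covered-next u covered′)))
    where
    u = fromℕ< (∸-monoʳ-< (s≤s z≤n) r<T)
    t≡ : toℕ u ≡ T ∸ suc r
    t≡ = Fin.toℕ-fromℕ< (∸-monoʳ-< (s≤s z≤n) r<T)
    suc-t≡ : suc (toℕ u) ≡ T ∸ r
    suc-t≡ = trans (cong suc t≡) (sym (+-∸-assoc 1 r<T))
    covered′ : CoveredUpTo C (toℕ u)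
    covered′ = subst (CoveredUpTo C) (sym t≡) covered

  greedyChunks : List (Fin (k + T))
  greedyChunks = lastChunks T ≤-refl

  greedyChunks-run : GreedyRun system greedyChunks
  greedyChunks-run = lastChunks-greedy T ≤-refl λ x →
    (λ x∈∅ → contradiction x∈∅ ∉⊥) ,
    (λ x<front → contradiction (subst (λ t → toℕ x < front t) (n∸n≡0 T) x<front) λ ())

  open import Data.List.Membership.DecPropositional (Fin._≟_ {k + T}) using () renaming (_∈?_ to _∈ₗ?_)

  columns : List (Fin (k + T))
  columns = List.tabulate column

  columns-cover : IsCover system columns
  columns-cover x = ∈-unionOf⁺ system (∈-tabulate⁺ {f = column} (columnOf x)) (proj₂ (system-covers x))

  -- The k points of the missing column need k different covering sets.
  cover-missing-column≥k : ∀ is → IsCover system is → ∀ i₀ → column i₀ ∉ₗ is → k ≤ length is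
  cover-missing-column≥k is covers i₀ i₀∉is = Fin.injective⇒≤ {f = coverer} coverer-injective
    where
    point<kk : ∀ (c : Fin k) → toℕ i₀ + toℕ c * k < kk
    point<kk c = column-point<kk i₀ (toℕ c) (Fin.toℕ<n c)
    point : Fin k → Fin kk
    point c = fromℕ< (point<kk c)
    coverer : Fin k → Fin (length is)
    coverer c = proj₁ (∈-unionOf⁻ system is (covers (point c)))
    point∈ : ∀ c → toℕ i₀ + toℕ c * k ∈ᵇ splitAt k (List.lookup is (coverer c))
    point∈ c = subst (_∈ᵇ splitAt k (List.lookup is (coverer c))) (Fin.toℕ-fromℕ< (point<kk c))
      (∈-system⁻ {List.lookup is (coverer c)} (proj₂ (∈-unionOf⁻ system is (covers (point c)))))
    coverer-injective : ∀ {c c′} → coverer c ≡ coverer c′ → c ≡ c′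
    coverer-injective {c} {c′} same = Fin.toℕ-injective (*-cancelʳ-≡ (toℕ c) (toℕ c′) k
      (+-cancelˡ-≡ (toℕ i₀) _ _ (points-equal (splitAt k set) refl)))
      where
      set = List.lookup is (coverer c)
      c′∈ : toℕ i₀ + toℕ c′ * k ∈ᵇ splitAt k set
      c′∈ = subst (λ o → toℕ i₀ + toℕ c′ * k ∈ᵇ splitAt k (List.lookup is o)) (sym same) (point∈ c′)
      -- The covering set is not a column, so it is a chunk, meeting column i₀ once.
      points-equal : ∀ b → splitAt k set ≡ b → toℕ i₀ + toℕ c * k ≡ toℕ i₀ + toℕ c′ * k
      points-equal (inj₁ i) split≡ = contradiction (subst (_∈ₗ is) set≡column (∈-lookup (coverer c))) i₀∉is
        where
        i≡i₀ : i ≡ i₀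
        i≡i₀ = Fin.toℕ-injective (trans (sym (subst (_ ∈ᵇ_) split≡ (point∈ c))) (column-point i₀ (toℕ c)))
        set≡column : set ≡ column i₀
        set≡column = splitAt-injective (trans split≡ (trans (cong inj₁ i≡i₀) (sym (Fin.splitAt-↑ˡ k i₀ T))))
      points-equal (inj₂ t) split≡ = column∩chunk-unique {i₀} {t}
        (column-point i₀ (toℕ c)) (subst (_ ∈ᵇ_) split≡ (point∈ c))
        (column-point i₀ (toℕ c′)) (subst (_ ∈ᵇ_) split≡ c′∈)

  cover≥k : ∀ is → IsCover system is → k ≤ length is
  cover≥k is covers with all? (λ i → column i ∈ₗ? is)
  ... | yes all∈is = Fin.injective⇒≤ {f = λ i → index (all∈is i)} λ {i} {j} same → Fin.↑ˡ-injective T i j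
    (trans (lookup-index (all∈is i)) (trans (cong (List.lookup is) same) (sym (lookup-index (all∈is j)))))
  ... | no ¬all∈is = let i₀ , i₀∉is = ¬∀⟶∃¬ k _ (λ i → column i ∈ₗ? is) ¬all∈is in
    cover-missing-column≥k is covers i₀ i₀∉is

  system-optimum : IsOptimum system k
  system-optimum = (columns , columns-cover , length-tabulate column) , cover≥k

  k*width+front≤ : ∀ t → front t ≤ kk → k * width t + front t ≤ kk + k
  k*width+front≤ t front≤kk = begin
    k * (k ∸ c) + front t            ≡⟨ cong (k * (k ∸ c) +_) (m≡m%n+[m/n]*n (front t) k) ⟩
    k * (k ∸ c) + (r + c * k)        ≡⟨ e k (k ∸ c) r c ⟩
    r + k * (k ∸ c + c)              ≡⟨ cong (λ z → r + k * z) (m∸n+n≡m c≤k) ⟩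
    r + k * k                        ≤⟨ +-monoˡ-≤ (k * k) (<⇒≤ (m%n<n (front t) k)) ⟩
    k + k * k                        ≡⟨ +-comm k kk ⟩
    kk + k                           ∎
    where
    open ≤-Reasoning
    c = front t / k
    r = front t % k
    c≤k : c ≤ k
    c≤k = ≤-trans (/-monoˡ-≤ k front≤kk) (≤-reflexive (m*n/n≡m k k))
    e : ∀ k A r c → k * A + (r + c * k) ≡ r + k * (A + c)
    e = solve-∀

  k₁ : ℕ
  k₁ = suc a

  slack : ℕ → ℕ
  slack t = (kk + k) ∸ front t

  -- A chunk is at most a k-th of the slack, as k * width t + front t ≤ kk + k.
  slack-step : ∀ t → front t < kk → k₁ * slack t ≤ k * slack (suc t)
  slack-step t front<kk = begin
    k₁ * slack t           ≡⟨ cong (k₁ *_) slack≡ ⟩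
    k₁ * (W + width t)     ≡⟨ *-distribˡ-+ k₁ W (width t) ⟩
    k₁ * W + k₁ * width t  ≤⟨ +-monoʳ-≤ (k₁ * W) k₁*width≤W ⟩
    k₁ * W + W             ≡⟨ +-comm (k₁ * W) W ⟩
    k * W                  ∎
    where
    open ≤-Reasoning
    W = slack (suc t)
    front′≤ : front (suc t) ≤ kk + k
    front′≤ = ≤-trans (front≤kk (suc t)) (m≤m+n kk k)
    slack≡ : slack t ≡ W + width t
    slack≡ = +-cancelʳ-≡ (front t) _ _ (begin-equality
      slack t + front t              ≡⟨ m∸n+n≡m (≤-trans (front≤kk t) (m≤m+n kk k)) ⟩
      kk + k                         ≡⟨ m∸n+n≡m front′≤ ⟨
      W + (front t + width t)        ≡⟨ cong (W +_) (+-comm (front t) (width t)) ⟩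
      W + (width t + front t)        ≡⟨ +-assoc W (width t) (front t) ⟨
      W + width t + front t          ∎)
    k₁*width≤W : k₁ * width t ≤ W
    k₁*width≤W = +-cancelʳ-≤ (width t + front t) _ _ (begin
      k₁ * width t + (width t + front t)  ≡⟨ +-assoc (k₁ * width t) (width t) (front t) ⟨
      k₁ * width t + width t + front t    ≡⟨ cong (_+ front t) (+-comm (k₁ * width t) (width t)) ⟩
      k * width t + front t               ≤⟨ k*width+front≤ t (front≤kk t) ⟩
      kk + k                              ≡⟨ m∸n+n≡m front′≤ ⟨
      W + front (suc t)                   ≡⟨ cong (W +_) (+-comm (front t) (width t)) ⟩
      W + (width t + front t)             ∎)

  slack-chain : ∀ t → t ≤ T → k₁ ^ t * slack 0 ≤ k ^ t * slack t
  slack-chain zero    _   = ≤-refl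
  slack-chain (suc t) t<T = begin
    k₁ * k₁ ^ t * slack 0          ≡⟨ *-assoc k₁ (k₁ ^ t) (slack 0) ⟩
    k₁ * (k₁ ^ t * slack 0)        ≤⟨ *-monoʳ-≤ k₁ (slack-chain t (<⇒≤ t<T)) ⟩
    k₁ * (k ^ t * slack t)         ≡⟨ x∙yz≈y∙xz k₁ (k ^ t) (slack t) ⟩
    k ^ t * (k₁ * slack t)         ≤⟨ *-monoʳ-≤ (k ^ t) (slack-step t (front<kk t<T)) ⟩
    k ^ t * (k * slack (suc t))    ≡⟨ x∙yz≈y∙xz (k ^ t) k (slack (suc t)) ⟩
    k * (k ^ t * slack (suc t))    ≡⟨ *-assoc k (k ^ t) (slack (suc t)) ⟨
    k * k ^ t * slack (suc t)      ∎
    where open ≤-Reasoning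

  chunks-many : k₁ ^ T * suc k ≤ k ^ T
  chunks-many = *-cancelʳ-≤ (k₁ ^ T * suc k) (k ^ T) k (begin
    k₁ ^ T * suc k * k        ≡⟨ *-assoc (k₁ ^ T) (suc k) k ⟩
    k₁ ^ T * (k + kk)         ≡⟨ cong (k₁ ^ T *_) (+-comm k kk) ⟩
    k₁ ^ T * slack 0          ≤⟨ slack-chain T ≤-refl ⟩
    k ^ T * slack T           ≡⟨ cong (λ f → k ^ T * ((kk + k) ∸ f)) front-T ⟩
    k ^ T * ((kk + k) ∸ kk)   ≡⟨ cong (k ^ T *_) (m+n∸m≡n kk k) ⟩
    k ^ T * k                 ∎)
    where open ≤-Reasoning

  -- (k / k₁) ^ (k₁ (T + k)) ≥ (k + 1) ^ k₁ · 2 ^ k > k ^ k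
  ratio-pow>k^k : k ^ k * k₁ ^ (k₁ * (T + k)) < k ^ (k₁ * (T + k))
  ratio-pow>k^k = begin-strict
    k ^ k * k₁ ^ h
      ≡⟨ cong (k ^ k *_) (split k₁) ⟩
    k ^ k * ((k₁ ^ T) ^ k₁ * (k₁ ^ k₁) ^ k)
      <⟨ *-monoˡ-< ((k₁ ^ T) ^ k₁ * (k₁ ^ k₁) ^ k) {{nonzero}} k^k< ⟩
    (suc k ^ k₁ * 2 ^ k) * ((k₁ ^ T) ^ k₁ * (k₁ ^ k₁) ^ k)
      ≡⟨ e (suc k ^ k₁) (2 ^ k) ((k₁ ^ T) ^ k₁) ((k₁ ^ k₁) ^ k) ⟩
    ((k₁ ^ T) ^ k₁ * suc k ^ k₁) * (2 ^ k * (k₁ ^ k₁) ^ k)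
      ≡⟨ cong₂ _*_ (^-distrib-* (k₁ ^ T) (suc k) k₁) (^-distrib-* 2 (k₁ ^ k₁) k) ⟨
    (k₁ ^ T * suc k) ^ k₁ * (2 * k₁ ^ k₁) ^ k
      ≤⟨ *-mono-≤ (^-monoˡ-≤ k₁ chunks-many) (^-monoˡ-≤ k (2*^≤suc^ a)) ⟩
    (k ^ T) ^ k₁ * (k ^ k₁) ^ k
      ≡⟨ split k ⟨
    k ^ h
      ∎
    where
    open ≤-Reasoning
    h = k₁ * (T + k)
    nonzero : NonZero ((k₁ ^ T) ^ k₁ * (k₁ ^ k₁) ^ k)
    nonzero = m*n≢0 _ _ {{m^n≢0 (k₁ ^ T) k₁ {{m^n≢0 k₁ T}}}} {{m^n≢0 (k₁ ^ k₁) k {{m^n≢0 k₁ k₁}}}}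
    e : ∀ A B C D → (A * B) * (C * D) ≡ (C * A) * (B * D)
    e = solve-∀
    e₂ : ∀ a T k → a * (T + k) ≡ T * a + a * k
    e₂ = solve-∀
    split : ∀ z → z ^ h ≡ (z ^ T) ^ k₁ * (z ^ k₁) ^ k
    split z = begin-equality
      z ^ (k₁ * (T + k))            ≡⟨ cong (z ^_) (e₂ k₁ T k) ⟩
      z ^ (T * k₁ + k₁ * k)         ≡⟨ ^-distribˡ-+-* z (T * k₁) (k₁ * k) ⟩
      z ^ (T * k₁) * z ^ (k₁ * k)   ≡⟨ cong₂ _*_ (^-*-assoc z T k₁) (^-*-assoc z k₁ k) ⟨
      (z ^ T) ^ k₁ * (z ^ k₁) ^ k   ∎
    k^k< : k ^ k < suc k ^ k₁ * 2 ^ k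
    k^k< = begin-strict
      k ^ k                ≡⟨ *-comm k (k ^ k₁) ⟩
      k ^ k₁ * k           <⟨ *-monoʳ-< (k ^ k₁) {{m^n≢0 k k₁}} (n<2^n k) ⟩
      k ^ k₁ * 2 ^ k       ≤⟨ *-monoˡ-≤ (2 ^ k) (^-monoˡ-≤ k₁ (n≤1+n k)) ⟩
      suc k ^ k₁ * 2 ^ k   ∎

  greedy-ExpGt : ExpGt (2 * (length greedyChunks + k)) (kk ^ k)
  greedy-ExpGt = ExpGt-of-^ k₁ x (kk ^ k) (begin-strict
    kk ^ k * k₁ ^ (k₁ * x)              ≡⟨ cong₂ (λ u v → u * k₁ ^ v) (^-distrib-* k k k) k₁x≡h+h ⟩
    k ^ k * k ^ k * k₁ ^ (h + h)        ≡⟨ cong (k ^ k * k ^ k *_) (^-distribˡ-+-* k₁ h h) ⟩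
    k ^ k * k ^ k * (k₁ ^ h * k₁ ^ h)   ≡⟨ [m*n]*[o*p]≡[m*o]*[n*p] (k ^ k) (k ^ k) (k₁ ^ h) (k₁ ^ h) ⟩
    k ^ k * k₁ ^ h * (k ^ k * k₁ ^ h)   <⟨ *-mono-< ratio-pow>k^k ratio-pow>k^k ⟩
    k ^ h * k ^ h                       ≡⟨ ^-distribˡ-+-* k h h ⟨
    k ^ (h + h)                         ≡⟨ cong (k ^_) k₁x≡h+h ⟨
    suc k₁ ^ (k₁ * x)                   ∎)
    where
    open ≤-Reasoning
    x = 2 * (length greedyChunks + k)
    h = k₁ * (T + k)
    e : ∀ c y → c * (2 * y) ≡ c * y + c * y
    e = solve-∀
    k₁x≡h+h : k₁ * x ≡ h + h
    k₁x≡h+h = trans (cong (λ l → k₁ * (2 * (l + k))) (length-lastChunks T ≤-refl)) (e k₁ (T + k))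

greedy-lower-bound : ∀ N → ∃ λ n → N ≤ n × (∃ λ m → ∃ λ (S : SetSystem n m) →
  Distinct S × Simple S × CoversUniverse S ×
  (∃ λ opt → IsOptimum S opt × (∃ λ G → GreedyRun S G × ExpGt (2 * (length G + opt)) (n ^ opt))))
greedy-lower-bound N = kk , N≤kk , k + T , system , system-distinct , system-simple , system-covers ,
  k , system-optimum , greedyChunks , greedyChunks-run , greedy-ExpGt
  where
  open GreedyLowerBound N
  N≤kk : N ≤ kk
  N≤kk = ≤-trans (≤-trans (n≤1+n N) (n≤1+n (suc N))) (m≤m*n k k)

theorem1p4 :
    (∀ (n m : ℕ) (S : SetSystem n m) → Distinct S → Simple S → CoversUniverse S →
      ∀ (opt : ℕ) → IsOptimum S opt →
      ∀ (G : List (Fin m)) → GreedyRun S G →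
      ExpLe (2 * (length G ∸ opt)) (n ^ opt))
    ×
    (∀ (N : ℕ) → ∃ λ (n : ℕ) → N ≤ n × (∃ λ (m : ℕ) → ∃ λ (S : SetSystem n m) →
      Distinct S × Simple S × CoversUniverse S ×
      (∃ λ (opt : ℕ) → IsOptimum S opt ×
        (∃ λ (G : List (Fin m)) → GreedyRun S G ×
          ExpGt (2 * (length G + opt)) (n ^ opt)))))
theorem1p4 =
  (λ n m S _ simple _ opt optimum G run → greedy-upper-bound S simple optimum run) , greedy-lower-bound
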